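{- Let $n$ be a positive integer and let $(X_i,Y_i,c_i)$, $i\in[k]$, be difference constraints on $[n]$. Let $V_1,\dots,V_h$ be the vertex sets of the strongly connected components of the dependency digraph. If the polymatroid bound of this instance is finite, then it is attained by a polymatroid function $h$ satisfying all constraints which is semimodular with respect to $V_1,\dots,V_h$, i.e., there exist polymatroid functions $h_j:2^{V_j}\to\mathbb{R}_{\ge0}$, $j\in[h]$, with $h(X)=\sum_{j\in[h]}h_j(X\cap V_j)$ for all $X\subseteq[n]$.
   Context: $[n]=\{1,\dots,n\}$. A difference constraint is a triple $(X,Y,c)$ with $X\subsetneq Y\subseteq[n]$ and $c$ real; $h$ satisfies it if $h(Y)-h(X)\le c$. A polymatroid function on a finite ground set $U$ is $h:2^U\to\mathbb{R}_{\ge 0}$ with $h(\emptyset)=0$, monotone ($h(X)\le h(Y)$ for $X\subseteq Y$) and submodular ($h(X\cup Y)+h(X\cap Y)\le h(X)+h(Y)$). The polymatroid bound of the instance is $\sup h([n])$ over polymatroid functions $h$ on $[n]$ satisfying all constraints. The dependency digraph has vertex set $[n]$ and an arc $(u,v)$ iff there is $i\in[k]$ with $u\in X_i$ and $v\in Y_i\setminus X_i$. -}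

module Defs where

open import Data.Nat using (ℕ; zero; suc)
open import Data.Fin using (Fin; zero; suc)
open import Data.Fin.Subset using (Subset; _∈_; _∉_; _⊆_; _⊂_; _∩_; _∪_; ⊤; ⊥)
open import Data.Product using (Σ; ∃; ∃-syntax; _×_; _,_)
open import Data.Empty using () renaming (⊥ to Empty)
open import Relation.Binary.PropositionalEquality using (_≡_; _≢_)
open import Relation.Binary.Construct.Closure.ReflexiveTransitive using (Star)
open import Data.Sum using (_⊎_)
open import Function.Bundles using (_⇔_)

module _ {A : Set} (_≤_ : A → A → Set) where
  IsUpperBound : (A → Set) → A → Set
  IsUpperBound P s = ∀ x → P x → x ≤ s

  IsLUB : (A → Set) → A → Set
  IsLUB P s = IsUpperBound P s × (∀ b → IsUpperBound P b → s ≤ b)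

record CompleteOrderedField : Set₁ where
  infixl 6 _+_
  infixl 7 _*_
  infix  8 -_
  infix  4 _≤_
  field
    Carrier : Set
    0# 1#   : Carrier
    _+_ _*_ : Carrier → Carrier → Carrier
    -_      : Carrier → Carrier
    _≤_     : Carrier → Carrier → Set
    +-assoc     : ∀ x y z → (x + y) + z ≡ x + (y + z)
    +-comm      : ∀ x y → x + y ≡ y + x
    +-identityˡ : ∀ x → 0# + x ≡ x
    -‿inverseˡ  : ∀ x → (- x) + x ≡ 0#
    *-assoc     : ∀ x y z → (x * y) * z ≡ x * (y * z)
    *-comm      : ∀ x y → x * y ≡ y * x
    *-identityˡ : ∀ x → 1# * x ≡ x
    distribˡ    : ∀ x y z → x * (y + z) ≡ x * y + x * z
    0≢1         : 0# ≢ 1#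
    *-inverse   : ∀ x → x ≢ 0# → ∃[ y ] (x * y ≡ 1#)
    ≤-refl      : ∀ x → x ≤ x
    ≤-trans     : ∀ {x y z} → x ≤ y → y ≤ z → x ≤ z
    ≤-antisym   : ∀ {x y} → x ≤ y → y ≤ x → x ≡ y
    ≤-total     : ∀ x y → (x ≤ y) ⊎ (y ≤ x)
    +-mono-≤    : ∀ {x y} z → x ≤ y → x + z ≤ y + z
    *-nonneg    : ∀ {x y} → 0# ≤ x → 0# ≤ y → 0# ≤ x * y
    complete    : (P : Carrier → Set) → ∃ P → ∃ (IsUpperBound _≤_ P) →
                  ∃ (IsLUB _≤_ P)

module _ (R : CompleteOrderedField) where
  open CompleteOrderedField R

  sumFin : ∀ {h} → (Fin h → Carrier) → Carrier
  sumFin {zero}  f = 0#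
  sumFin {suc h} f = f zero + sumFin (λ j → f (suc j))

  record DiffConstraint (n : ℕ) : Set where
    field
      X Y    : Subset n
      c      : Carrier
      X⊂Y    : X ⊂ Y

  SatisfiesDC : ∀ {n} → (Subset n → Carrier) → DiffConstraint n → Set
  SatisfiesDC h dc = h Y + (- h X) ≤ c
    where open DiffConstraint dc

  SatisfiesAll : ∀ {n k} → (Fin k → DiffConstraint n) → (Subset n → Carrier) → Set
  SatisfiesAll C h = ∀ i → SatisfiesDC h (C i)

  -- f is a polymatroid function on the ground set U ⊆ [n], i.e. the
  -- restriction of f to 2^U is a polymatroid (values of f on sets not
  -- contained in U are irrelevant).
  record IsPolymatroidOn {n} (U : Subset n) (f : Subset n → Carrier) : Set where
    field
      empty      : f ⊥ ≡ 0#
      nonneg     : ∀ X → X ⊆ U → 0# ≤ f X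
      monotone   : ∀ X Y → X ⊆ U → Y ⊆ U → X ⊆ Y → f X ≤ f Y
      submodular : ∀ X Y → X ⊆ U → Y ⊆ U → f (X ∪ Y) + f (X ∩ Y) ≤ f X + f Y

  IsPolymatroid : ∀ {n} → (Subset n → Carrier) → Set
  IsPolymatroid = IsPolymatroidOn ⊤

  FeasibleValue : ∀ {n k} → (Fin k → DiffConstraint n) → Carrier → Set
  FeasibleValue {n} C b =
    Σ (Subset n → Carrier) λ h → IsPolymatroid h × SatisfiesAll C h × h ⊤ ≡ b

  PolymatroidBoundIs : ∀ {n k} → (Fin k → DiffConstraint n) → Carrier → Set
  PolymatroidBoundIs C B = IsLUB _≤_ (FeasibleValue C) B

  Arc : ∀ {n k} → (Fin k → DiffConstraint n) → Fin n → Fin n → Set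
  Arc C u v = ∃[ i ] (u ∈ DiffConstraint.X (C i) × v ∈ DiffConstraint.Y (C i)
                      × v ∉ DiffConstraint.X (C i))

  StronglyConnected : ∀ {n k} → (Fin k → DiffConstraint n) → Fin n → Fin n → Set
  StronglyConnected C u v = Star (Arc C) u v × Star (Arc C) v u

  record IsSCCDecomposition {n k h} (C : Fin k → DiffConstraint n)
                            (V : Fin h → Subset n) : Set where
    field
      nonempty : ∀ j → ∃[ u ] (u ∈ V j)
      covers   : ∀ u → ∃[ j ] (u ∈ V j)
      disjoint : ∀ j j' u → u ∈ V j → u ∈ V j' → j ≡ j'
      classes  : ∀ j u v → u ∈ V j → (v ∈ V j ⇔ StronglyConnected C u v)

  SemimodularWrt : ∀ {n h} → (Fin h → Subset n) → (Subset n → Carrier) → Set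
  SemimodularWrt {n} {h} V f =
    Σ (Fin h → Subset n → Carrier) λ hs →
      (∀ j → IsPolymatroidOn (V j) (hs j)) ×
      (∀ X → f X ≡ sumFin (λ j → hs j (X ∩ V j)))

module Submission where

-- The polymatroid bound is the optimum of a finite linear program in the values h(X), so Fourier–Motzkin
-- elimination of every variable but h([n]) shows that a finite bound is attained by a polymatroid g.
-- Number the strong components so that arcs between components go up (by the number of vertices that
-- reach a component), let Pⱼ be the union of the components before Vⱼ and hⱼ(S) = g(Pⱼ ∪ S) − g(Pⱼ).
-- Then f(X) = Σⱼ hⱼ(X ∩ Vⱼ) is a polymatroid, f([n]) ≥ g([n]) by telescoping, and f satisfies each
-- constraint (X, Y, c): along the sets X ∪ (Y ∩ Pⱼ) running from X to Y, submodularity bounds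
-- hⱼ(Y ∩ Vⱼ) − hⱼ(X ∩ Vⱼ) by the increment of g, since X lies in Vⱼ ∪ Pⱼ whenever Y − X meets Vⱼ.
-- Summing, f(Y) − f(X) ≤ g(Y) − g(X) ≤ c.

open import Defs
open import Algebra.Bundles using (CommutativeRing; RawRing)
open import Data.Bool as Bool using (true; false)
open import Data.Empty using (⊥-elim)
open import Data.Fin using (Fin; zero; suc; toℕ)
import Data.Fin.Properties as Fin
open import Data.Fin.Subset using (Subset; _⊆_; _∪_; _∩_; ⊤; ⊥; ∣_∣)
open import Data.Fin.Subset.Properties
  using (_∈?_; p⊂q⇒∣p∣<∣q∣; ∣p∣≤n; ⊆-antisym; ⊥⊆; ⊆⊤; p⊆p∪q; q⊆p∪q; x∈p∪q⁻; x∈p∪q⁺; x∈p∩q⁻; x∈p∩q⁺;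
         ∪-distribˡ-∩; ∩-distribʳ-∪; ∪-identityʳ; ∩-zeroˡ; ∩-zeroʳ; ∩-identityˡ; ∩-identityʳ;
         ∪-idempotentCommutativeMonoid; ∩-idempotentCommutativeMonoid)
open import Data.List as List using (List; []; _∷_; _++_; concat; replicate; map; filter; cartesianProductWith)
import Data.List.Membership.Propositional as List
open import Data.List.Membership.Propositional.Properties using (∈-cartesianProductWith⁺; ∈-filter⁺; ∈-++⁺ˡ; ∈-++⁺ʳ; ∈-map⁺)
open import Data.List.Relation.Unary.All as All using (All; []; _∷_)
import Data.List.Relation.Unary.All.Properties as All
open import Data.List.Relation.Unary.Any using (here; there)
open import Data.Maybe using (Maybe; just; nothing)
open import Data.Nat as ℕ using (ℕ; zero; suc; less; equal; greater)
import Data.Nat.Properties as ℕ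
open import Data.Product using (Σ; ∃-syntax; _×_; _,_; proj₁; proj₂)
open import Data.Sum as Sum using (_⊎_; inj₁; inj₂; [_,_]′)
open import Data.Vec as Vec using () renaming ([] to []ᵥ; _∷_ to _∷ᵥ_)
import Data.Vec.Properties as Vecₚ
open import Function using (id; _∘_; _⇔_; mk⇔; Equivalence)
open import Function.Construct.Composition using (_⇔-∘_)
open import Function.Construct.Identity using (⇔-id)
open import Relation.Binary.Bundles using (TotalOrder)
open import Relation.Binary.Construct.Closure.ReflexiveTransitive using (Star; ε; _◅_; _◅◅_)
open import Relation.Binary.Definitions using (DecidableEquality; tri<; tri≈; tri>)
open import Relation.Binary.PropositionalEquality
open import Relation.Nullary using (¬_; Dec; does; yes; no; ¬?)
open import Relation.Nullary.Decidable using (dec-true; _×-dec_)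
import Algebra.Solver.CommutativeMonoid as MonoidSolver
import Algebra.Solver.IdempotentCommutativeMonoid as LatticeSolver
import Algebra.Solver.Ring.AlmostCommutativeRing as ACR
import Relation.Binary.Reasoning.PartialOrder as PartialOrderReasoning

module OrderedField (R : CompleteOrderedField) where
  open CompleteOrderedField R public
  open ≡-Reasoning

  +-identityʳ : ∀ x → x + 0# ≡ x
  +-identityʳ x = trans (+-comm x 0#) (+-identityˡ x)

  -‿inverseʳ : ∀ x → x + - x ≡ 0#
  -‿inverseʳ x = trans (+-comm x (- x)) (-‿inverseˡ x)

  commutativeRing : CommutativeRing _ _
  commutativeRing = record
    { Carrier = Carrier ; _≈_ = _≡_ ; _+_ = _+_ ; _*_ = _*_ ; -_ = -_ ; 0# = 0# ; 1# = 1#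
    ; isCommutativeRing = record
      { isRing = record
        { +-isAbelianGroup = record
          { isGroup = record
            { isMonoid = record
              { isSemigroup = record
                { isMagma = record { isEquivalence = isEquivalence ; ∙-cong = cong₂ _+_ }
                ; assoc = +-assoc }
              ; identity = +-identityˡ , +-identityʳ }
            ; inverse = -‿inverseˡ , -‿inverseʳ
            ; ⁻¹-cong = cong -_ }
          ; comm = +-comm }
        ; *-cong = cong₂ _*_
        ; *-assoc = *-assoc
        ; *-identity = *-identityˡ , λ x → trans (*-comm x 1#) (*-identityˡ x)
        ; distrib = distribˡ , λ x y z → begin
            (y + z) * x     ≡⟨ *-comm (y + z) x ⟩
            x * (y + z)     ≡⟨ distribˡ x y z ⟩
            x * y + x * z   ≡⟨ cong₂ _+_ (*-comm x y) (*-comm x z) ⟩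
            y * x + z * x   ∎ }
      ; *-comm = *-comm } }

  open CommutativeRing commutativeRing public using (_-_; +-commutativeMonoid; semiring; zeroˡ; zeroʳ; distribʳ)
  open import Algebra.Properties.Ring (CommutativeRing.ring commutativeRing) public
    using (-‿involutive; -0#≈0#; -‿distribˡ-*; -‿+-comm; ⁻¹-anti-homo‿-; x[y-z]≈xy-xz; [y-z]x≈yx-zx)
  open import Algebra.Properties.Semiring.Mult semiring
    using (×-homo-+; ×1-homo-*) renaming (_×_ to _×ℕ_)

  ι : ℕ → Carrier
  ι m = m ×ℕ 1#

  ι-+ : ∀ m n → ι (m ℕ.+ n) ≡ ι m + ι n
  ι-+ = ×-homo-+ 1#

  private module +-Solver = MonoidSolver +-commutativeMonoid

  -- Solver coefficients: a pair (a , b) of naturals stands for a − b. Pairs are not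
  -- normalised, so only coefficients cancelling to 0 are recognised: an identity like
  -- x + x − x = x has to be stated with two variables.
  private
    ℤ² : RawRing _ _
    ℤ² = record
      { Carrier = ℕ × ℕ ; _≈_ = _≡_
      ; _+_ = λ { (a , b) (c , d) → a ℕ.+ c , b ℕ.+ d }
      ; _*_ = λ { (a , b) (c , d) → a ℕ.* c ℕ.+ b ℕ.* d , a ℕ.* d ℕ.+ b ℕ.* c }
      ; -_ = λ { (a , b) → b , a }
      ; 0# = 0 , 0 ; 1# = 1 , 0 }

    ⟦_⟧ℤ : ℕ × ℕ → Carrier
    ⟦ a , b ⟧ℤ = ι a - ι b

    ⟦⟧ℤ-+ : ∀ a b c d → ⟦ a ℕ.+ c , b ℕ.+ d ⟧ℤ ≡ ⟦ a , b ⟧ℤ + ⟦ c , d ⟧ℤ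
    ⟦⟧ℤ-+ a b c d = begin
      ι (a ℕ.+ c) - ι (b ℕ.+ d)        ≡⟨ cong₂ _-_ (ι-+ a c) (ι-+ b d) ⟩
      (ι a + ι c) - (ι b + ι d)        ≡⟨ cong (ι a + ι c +_) (sym (-‿+-comm (ι b) (ι d))) ⟩
      (ι a + ι c) + (- ι b + - ι d)    ≡⟨ +-Solver.solve 4 (λ p q r s → (p ⊕ q) ⊕ (r ⊕ s) ⊜ (p ⊕ r) ⊕ (q ⊕ s))
                                            refl (ι a) (ι c) (- ι b) (- ι d) ⟩
      (ι a - ι b) + (ι c - ι d)        ∎
      where open +-Solver using (_⊕_; _⊜_)

    ⟦⟧ℤ-* : ∀ a b c d → ⟦ a ℕ.* c ℕ.+ b ℕ.* d , a ℕ.* d ℕ.+ b ℕ.* c ⟧ℤ ≡ ⟦ a , b ⟧ℤ * ⟦ c , d ⟧ℤ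
    ⟦⟧ℤ-* a b c d = begin
      ι (a ℕ.* c ℕ.+ b ℕ.* d) - ι (a ℕ.* d ℕ.+ b ℕ.* c)
        ≡⟨ cong₂ _-_ (ι-sum-of-products a c b d) (ι-sum-of-products a d b c) ⟩
      (A * C + B * D) - (A * D + B * C)
        ≡⟨ cong (A * C + B * D +_) (sym (-‿+-comm (A * D) (B * C))) ⟩
      (A * C + B * D) + (- (A * D) + - (B * C))
        ≡⟨ +-Solver.solve 4 (λ p q r s → (p ⊕ q) ⊕ (r ⊕ s) ⊜ (p ⊕ s) ⊕ (q ⊕ r)) refl (A * C) (B * D) (- (A * D)) (- (B * C)) ⟩
      (A * C - B * C) + (B * D - A * D)
        ≡⟨ cong (A * C - B * C +_) (sym (⁻¹-anti-homo‿- (A * D) (B * D))) ⟩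
      (A * C - B * C) - (A * D - B * D)
        ≡⟨ sym (cong₂ _-_ ([y-z]x≈yx-zx C A B) ([y-z]x≈yx-zx D A B)) ⟩
      (A - B) * C - (A - B) * D
        ≡⟨ sym (x[y-z]≈xy-xz (A - B) C D) ⟩
      (A - B) * (C - D) ∎
      where
      open +-Solver using (_⊕_; _⊜_)
      A B C D : Carrier
      A = ι a ; B = ι b ; C = ι c ; D = ι d
      ι-sum-of-products : ∀ p q r s → ι (p ℕ.* q ℕ.+ r ℕ.* s) ≡ ι p * ι q + ι r * ι s
      ι-sum-of-products p q r s = trans (ι-+ (p ℕ.* q) (r ℕ.* s)) (cong₂ _+_ (×1-homo-* p q) (×1-homo-* r s))

    ⟦⟧ℤ-shift : ∀ a b d → ⟦ a ℕ.+ d , b ℕ.+ d ⟧ℤ ≡ ⟦ a , b ⟧ℤ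
    ⟦⟧ℤ-shift a b d = begin
      ⟦ a ℕ.+ d , b ℕ.+ d ⟧ℤ   ≡⟨ ⟦⟧ℤ-+ a b d d ⟩
      ⟦ a , b ⟧ℤ + (ι d - ι d) ≡⟨ cong (⟦ a , b ⟧ℤ +_) (-‿inverseʳ (ι d)) ⟩
      ⟦ a , b ⟧ℤ + 0#          ≡⟨ +-identityʳ _ ⟩
      ⟦ a , b ⟧ℤ               ∎

    ⟦⟧ℤ-equal? : ∀ p q → Maybe (⟦ p ⟧ℤ ≡ ⟦ q ⟧ℤ)
    ⟦⟧ℤ-equal? (a , b) (c , d) with a ℕ.+ d ℕ.≟ c ℕ.+ b
    ... | no _  = nothing
    ... | yes e = just (begin
      ⟦ a , b ⟧ℤ                ≡⟨ sym (⟦⟧ℤ-shift a b d) ⟩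
      ⟦ a ℕ.+ d , b ℕ.+ d ⟧ℤ    ≡⟨ cong₂ (λ u v → ⟦ u , v ⟧ℤ) e (ℕ.+-comm b d) ⟩
      ⟦ c ℕ.+ b , d ℕ.+ b ⟧ℤ    ≡⟨ ⟦⟧ℤ-shift c d b ⟩
      ⟦ c , d ⟧ℤ                ∎)

    almostCommutativeRing : ACR.AlmostCommutativeRing _ _
    almostCommutativeRing = ACR.fromCommutativeRing commutativeRing

    ⟦⟧ℤ-homomorphism : ℤ² ACR.-Raw-AlmostCommutative⟶ almostCommutativeRing
    ⟦⟧ℤ-homomorphism = record
      { ⟦_⟧ = ⟦_⟧ℤ
      ; +-homo = λ { (a , b) (c , d) → ⟦⟧ℤ-+ a b c d }
      ; *-homo = λ { (a , b) (c , d) → ⟦⟧ℤ-* a b c d }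
      ; -‿homo = λ { (a , b) → sym (⁻¹-anti-homo‿- (ι a) (ι b)) }
      ; 0-homo = -‿inverseʳ 0#
      ; 1-homo = trans (cong (_- 0#) (+-identityʳ 1#)) (trans (cong (1# +_) -0#≈0#) (+-identityʳ 1#)) }

  open import Algebra.Solver.Ring ℤ² almostCommutativeRing ⟦⟧ℤ-homomorphism ⟦⟧ℤ-equal? public
    using (solve; _:=_; _:+_; _:*_; :-_; _:-_)

  ≤-reflexive : ∀ {x y} → x ≡ y → x ≤ y
  ≤-reflexive refl = ≤-refl _

  ≤-cong : ∀ {x y b} → x ≡ y → (x ≤ b) ⇔ (y ≤ b)
  ≤-cong refl = ⇔-id _

  ≤-rearrange : ∀ {x y x′ y′} t → x + t ≡ x′ → y + t ≡ y′ → x ≤ y → x′ ≤ y′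
  ≤-rearrange t refl refl x≤y = +-mono-≤ t x≤y

  +-monoʳ-≤ : ∀ {x y} z → x ≤ y → z + x ≤ z + y
  +-monoʳ-≤ {x} {y} z = ≤-rearrange z (+-comm x z) (+-comm y z)

  +-mono₂-≤ : ∀ {x y u v} → x ≤ y → u ≤ v → x + u ≤ y + v
  +-mono₂-≤ {y = y} {u} x≤y u≤v = ≤-trans (+-mono-≤ u x≤y) (+-monoʳ-≤ y u≤v)

  x≤y⇒0≤y-x : ∀ {x y} → x ≤ y → 0# ≤ y - x
  x≤y⇒0≤y-x {x} {y} = ≤-rearrange (- x) (-‿inverseʳ x) refl

  0≤y-x⇒x≤y : ∀ {x y} → 0# ≤ y - x → x ≤ y
  0≤y-x⇒x≤y {x} {y} = ≤-rearrange x (+-identityˡ x) (solve 2 (λ x y → y :- x :+ x := y) refl x y)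

  x≤y⇒x-y≤0 : ∀ {x y} → x ≤ y → x - y ≤ 0#
  x≤y⇒x-y≤0 {x} {y} = ≤-rearrange (- y) refl (-‿inverseʳ y)

  x-y≤0⇒x≤y : ∀ {x y} → x - y ≤ 0# → x ≤ y
  x-y≤0⇒x≤y {x} {y} = ≤-rearrange y (solve 2 (λ x y → x :- y :+ y := x) refl x y) (+-identityˡ y)

  -‿anti-mono-≤ : ∀ {x y} → x ≤ y → - y ≤ - x
  -‿anti-mono-≤ {x} {y} = ≤-rearrange (- x - y) (solve 2 (λ x y → x :+ (:- x :- y) := :- y) refl x y)
                                                 (solve 2 (λ x y → y :+ (:- x :- y) := :- x) refl x y)

  0≤x⇒-x≤0 : ∀ {x} → 0# ≤ x → - x ≤ 0#
  0≤x⇒-x≤0 0≤x = subst (_ ≤_) -0#≈0# (-‿anti-mono-≤ 0≤x)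

  *-monoˡ-≤-nonneg : ∀ {x y} z → 0# ≤ z → x ≤ y → z * x ≤ z * y
  *-monoˡ-≤-nonneg {x} {y} z 0≤z x≤y = 0≤y-x⇒x≤y (subst (0# ≤_) (x[y-z]≈xy-xz z y x) (*-nonneg 0≤z (x≤y⇒0≤y-x x≤y)))

  *-monoˡ-≤-nonpos : ∀ {x y} z → z ≤ 0# → x ≤ y → z * y ≤ z * x
  *-monoˡ-≤-nonpos {x} {y} z z≤0 x≤y = ≤-rearrange (z * x + z * y)
    (solve 3 (λ x y z → :- z :* x :+ (z :* x :+ z :* y) := z :* y) refl x y z)
    (solve 3 (λ x y z → :- z :* y :+ (z :* x :+ z :* y) := z :* x) refl x y z)
    (*-monoˡ-≤-nonneg (- z) (subst (_≤ - z) -0#≈0# (-‿anti-mono-≤ z≤0)) x≤y)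

  0≤1 : 0# ≤ 1#
  0≤1 with ≤-total 0# 1#
  ... | inj₁ 0≤1 = 0≤1
  ... | inj₂ 1≤0 = subst (0# ≤_) (trans (solve 1 (λ o → :- o :* :- o := o :* o) refl 1#) (*-identityˡ 1#)) (*-nonneg 0≤-1 0≤-1)
    where
    0≤-1 : 0# ≤ - 1#
    0≤-1 = subst (_≤ - 1#) -0#≈0# (-‿anti-mono-≤ 1≤0)

  1≰0 : ¬ 1# ≤ 0#
  1≰0 1≤0 = 0≢1 (≤-antisym 0≤1 1≤0)

  ι-less : ∀ p k → ι p - ι (suc (p ℕ.+ k)) ≡ - ι (suc k)
  ι-less p k = trans (cong (λ z → ι p - (1# + z)) (ι-+ p k))
    (solve 3 (λ o p k → p :- (o :+ (p :+ k)) := :- (o :+ k)) refl 1# (ι p) (ι k))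

  ι-greater : ∀ q k → ι (suc (q ℕ.+ k)) - ι q ≡ ι (suc k)
  ι-greater q k = trans (cong (λ z → 1# + z - ι q) (ι-+ q k))
    (solve 3 (λ o q k → o :+ (q :+ k) :- q := o :+ k) refl 1# (ι q) (ι k))

  ι-nonneg : ∀ m → 0# ≤ ι m
  ι-nonneg zero    = ≤-refl 0#
  ι-nonneg (suc m) = subst (_≤ ι (suc m)) (+-identityʳ 0#) (+-mono₂-≤ 0≤1 (ι-nonneg m))

  1≤ι-suc : ∀ m → 1# ≤ ι (suc m)
  1≤ι-suc m = subst (_≤ ι (suc m)) (+-identityʳ 1#) (+-monoʳ-≤ 1# (ι-nonneg m))

  private
    reciprocal : ∀ m → Σ Carrier λ e → ι (suc m) * e ≡ 1# × 0# ≤ e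
    reciprocal m with *-inverse (ι (suc m)) (λ ι≡0 → 1≰0 (subst (1# ≤_) ι≡0 (1≤ι-suc m)))
    ... | e , ιe≡1 with ≤-total 0# e
    ...   | inj₁ 0≤e = e , ιe≡1 , 0≤e
    ...   | inj₂ e≤0 = ⊥-elim (1≰0 (subst₂ _≤_ ιe≡1 (zeroʳ (ι (suc m)))
                                      (*-monoˡ-≤-nonneg (ι (suc m)) (ι-nonneg (suc m)) e≤0)))

  1/[1+_] : ℕ → Carrier
  1/[1+ m ] = proj₁ (reciprocal m)

  ι*1/[1+m]≡1 : ∀ m → ι (suc m) * 1/[1+ m ] ≡ 1#
  ι*1/[1+m]≡1 m = proj₁ (proj₂ (reciprocal m))

  1/[1+m]-nonneg : ∀ m → 0# ≤ 1/[1+ m ]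
  1/[1+m]-nonneg m = proj₂ (proj₂ (reciprocal m))

  ι-suc-cancel : ∀ m x → ι (suc m) * (x * 1/[1+ m ]) ≡ x
  ι-suc-cancel m x = begin
    ι (suc m) * (x * 1/[1+ m ])   ≡⟨ solve 3 (λ d x e → d :* (x :* e) := (d :* e) :* x) refl (ι (suc m)) x 1/[1+ m ] ⟩
    (ι (suc m) * 1/[1+ m ]) * x   ≡⟨ cong (_* x) (ι*1/[1+m]≡1 m) ⟩
    1# * x                        ≡⟨ *-identityˡ x ⟩
    x                             ∎

  -- Completeness decides ¬ P: the supremum of {0} ∪ {2 | P} is 0 or 2.
  weak-excluded-middle : (P : Set) → ¬ P ⊎ ¬ ¬ P
  weak-excluded-middle P with complete Candidates (0# , inj₁ refl) (2# , 2-upper-bound)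
    where
    2# = 1# + 1#
    Candidates : Carrier → Set
    Candidates z = z ≡ 0# ⊎ (P × z ≡ 2#)
    2-upper-bound : IsUpperBound _≤_ Candidates 2#
    2-upper-bound _ (inj₁ refl)       = subst (_≤ 2#) (+-identityʳ 0#) (+-mono₂-≤ 0≤1 0≤1)
    2-upper-bound _ (inj₂ (_ , refl)) = ≤-refl 2#
  ... | s , s-upper , s-least with ≤-total s 1#
  ...   | inj₁ s≤1 = inj₁ λ p → 1≰0 (≤-rearrange (- 1#) (solve 2 (λ a b → a :+ b :- b := a) refl 1# 1#) (-‿inverseʳ 1#)
                                      (≤-trans (s-upper _ (inj₂ (p , refl))) s≤1))
  ...   | inj₂ 1≤s = inj₂ λ ¬p → 1≰0 (≤-trans 1≤s (s-least 0# λ { _ (inj₁ refl) → ≤-refl 0#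
                                                               ; _ (inj₂ (p , _)) → ⊥-elim (¬p p) }))

  ¬¬? : (P : Set) → Dec (¬ ¬ P)
  ¬¬? P with weak-excluded-middle P
  ... | inj₁ ¬p  = no λ ¬¬p → ¬¬p ¬p
  ... | inj₂ ¬¬p = yes ¬¬p

  ≤-totalOrder : TotalOrder _ _ _
  ≤-totalOrder = record
    { Carrier = Carrier ; _≈_ = _≡_ ; _≤_ = _≤_
    ; isTotalOrder = record
      { isPartialOrder = record
        { isPreorder = record { isEquivalence = isEquivalence ; reflexive = ≤-reflexive ; trans = ≤-trans }
        ; antisym = ≤-antisym }
      ; total = ≤-total } }

  module ≤-Reasoning = PartialOrderReasoning (TotalOrder.poset ≤-totalOrder)

  open import Data.List.Extrema ≤-totalOrder using (max; min; xs≤max; max≤v⁺; min≤xs)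

  ∃-between : ∀ {A B : Set} (f : A → Carrier) (g : B → Carrier) as bs →
              (∀ {a b} → a List.∈ as → b List.∈ bs → f a ≤ g b) →
              ∃[ c ] All (λ a → f a ≤ c) as × All (λ b → c ≤ g b) bs
  ∃-between f g as bs f≤g = c , All.map⁻ (xs≤max _ (map f as)) , All.tabulate λ b∈ →
      max≤v⁺ (All.lookup (All.map⁻ (min≤xs 0# (map g bs))) b∈) (All.map⁺ (All.tabulate λ a∈ → f≤g a∈ b∈))
    where
    c : Carrier
    c = max (min 0# (map g bs)) (map f as)

module FiniteSums (R : CompleteOrderedField) where
  open OrderedField R
  open ≡-Reasoning
  private module +-Solver = MonoidSolver +-commutativeMonoid

  Σ[_] : ∀ {h} → (Fin h → Carrier) → Carrier
  Σ[_] = sumFin R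

  Σ-cong : ∀ {h} {a b : Fin h → Carrier} → (∀ j → a j ≡ b j) → Σ[ a ] ≡ Σ[ b ]
  Σ-cong {zero}  a≗b = refl
  Σ-cong {suc h} a≗b = cong₂ _+_ (a≗b zero) (Σ-cong (a≗b ∘ suc))

  Σ-mono-≤ : ∀ {h} {a b : Fin h → Carrier} → (∀ j → a j ≤ b j) → Σ[ a ] ≤ Σ[ b ]
  Σ-mono-≤ {zero}  a≤b = ≤-refl 0#
  Σ-mono-≤ {suc h} a≤b = +-mono₂-≤ (a≤b zero) (Σ-mono-≤ (a≤b ∘ suc))

  Σ-zero : ∀ {h} {a : Fin h → Carrier} → (∀ j → a j ≡ 0#) → Σ[ a ] ≡ 0#
  Σ-zero {zero}  a≗0 = refl
  Σ-zero {suc h} a≗0 = trans (cong₂ _+_ (a≗0 zero) (Σ-zero (a≗0 ∘ suc))) (+-identityʳ 0#)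

  Σ-+ : ∀ {h} (a b : Fin h → Carrier) → Σ[ (λ j → a j + b j) ] ≡ Σ[ a ] + Σ[ b ]
  Σ-+ {zero}  a b = sym (+-identityʳ 0#)
  Σ-+ {suc h} a b = trans (cong (a zero + b zero +_) (Σ-+ (a ∘ suc) (b ∘ suc)))
    (+-Solver.solve 4 (λ p q r s → (p ⊕ q) ⊕ (r ⊕ s) ⊜ (p ⊕ r) ⊕ (q ⊕ s)) refl (a zero) (b zero) Σ[ a ∘ suc ] Σ[ b ∘ suc ])
    where open +-Solver using (_⊕_; _⊜_)

  Σ-- : ∀ {h} (a : Fin h → Carrier) → Σ[ (λ j → - a j) ] ≡ - Σ[ a ]
  Σ-- {zero}  a = sym -0#≈0#
  Σ-- {suc h} a = trans (cong (- a zero +_) (Σ-- (a ∘ suc))) (-‿+-comm (a zero) Σ[ a ∘ suc ])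

  Σ-difference : ∀ {h} (a b : Fin h → Carrier) → Σ[ (λ j → a j - b j) ] ≡ Σ[ a ] - Σ[ b ]
  Σ-difference a b = trans (Σ-+ a (λ j → - b j)) (cong (Σ[ a ] +_) (Σ-- b))

  Σ-single : ∀ {h} {a : Fin h → Carrier} j → (∀ i → i ≢ j → a i ≡ 0#) → Σ[ a ] ≡ a j
  Σ-single {suc h} {a} zero    a≗0 = trans (cong (a zero +_) (Σ-zero λ i → a≗0 (suc i) λ ())) (+-identityʳ (a zero))
  Σ-single {suc h} {a} (suc j) a≗0 = trans (cong (_+ Σ[ a ∘ suc ]) (a≗0 zero λ ()))
    (trans (+-identityˡ _) (Σ-single j λ i i≢j → a≗0 (suc i) (i≢j ∘ Fin.suc-injective)))

  sumBelow : ℕ → (ℕ → Carrier) → Carrier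
  sumBelow zero    Δ = 0#
  sumBelow (suc N) Δ = sumBelow N Δ + Δ N

  sumBelow-telescope : ∀ (G : ℕ → Carrier) N → sumBelow N (λ m → G (suc m) - G m) ≡ G N - G 0
  sumBelow-telescope G zero    = sym (-‿inverseʳ (G 0))
  sumBelow-telescope G (suc N) = trans (cong (_+ (G (suc N) - G N)) (sumBelow-telescope G N))
    (solve 3 (λ a b c → b :- a :+ (c :- b) := c :- a) refl (G 0) (G N) (G (suc N)))

  module _ {h} (key : Fin h → ℕ) (key-injective : ∀ {i j} → key i ≡ key j → i ≡ j) (Δ : ℕ → Carrier)
           (Δ-vanishes : ∀ m → (∀ j → key j ≢ m) → Δ m ≡ 0#) where

    private
      below : ℕ → Fin h → Carrier
      below M j with key j ℕ.<? M
      ... | yes _ = Δ (key j)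
      ... | no _  = 0#

      at : ℕ → Fin h → Carrier
      at M j with key j ℕ.≟ M
      ... | yes _ = Δ M
      ... | no _  = 0#

      below-suc : ∀ M j → below (suc M) j ≡ below M j + at M j
      below-suc M j with key j ℕ.<? suc M | key j ℕ.<? M | key j ℕ.≟ M
      ... | yes _   | yes k<M | yes k≡M = ⊥-elim (ℕ.<-irrefl k≡M k<M)
      ... | yes _   | yes _   | no _    = sym (+-identityʳ _)
      ... | yes _   | no _    | yes refl = sym (+-identityˡ _)
      ... | yes k<1+M | no k≮M | no k≢M = ⊥-elim (k≢M (ℕ.≤-antisym (ℕ.s≤s⁻¹ k<1+M) (ℕ.≮⇒≥ k≮M)))
      ... | no k≮1+M | yes k<M | _      = ⊥-elim (k≮1+M (ℕ.m<n⇒m<1+n k<M))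
      ... | no k≮1+M | no _    | yes refl = ⊥-elim (k≮1+M (ℕ.n<1+n _))
      ... | no _    | no _    | no _    = sym (+-identityˡ 0#)

      Σ-at : ∀ M → Σ[ at M ] ≡ Δ M
      Σ-at M with Fin.any? (λ j → key j ℕ.≟ M)
      ... | no ∄j = trans (Σ-zero at≗0) (sym (Δ-vanishes M λ j k≡M → ∄j (j , k≡M)))
        where
        at≗0 : ∀ j → at M j ≡ 0#
        at≗0 j with key j ℕ.≟ M
        ... | yes k≡M = ⊥-elim (∄j (j , k≡M))
        ... | no _    = refl
      ... | yes (j , kj≡M) = trans (Σ-single j others≗0) at-j
        where
        others≗0 : ∀ i → i ≢ j → at M i ≡ 0#
        others≗0 i i≢j with key i ℕ.≟ M
        ... | yes ki≡M = ⊥-elim (i≢j (key-injective (trans ki≡M (sym kj≡M))))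
        ... | no _     = refl
        at-j : at M j ≡ Δ M
        at-j with key j ℕ.≟ M
        ... | yes _    = refl
        ... | no kj≢M = ⊥-elim (kj≢M kj≡M)

      Σ-below : ∀ M → Σ[ below M ] ≡ sumBelow M Δ
      Σ-below zero    = Σ-zero below-0
        where
        below-0 : ∀ j → below 0 j ≡ 0#
        below-0 j with key j ℕ.<? 0
        ... | no _ = refl
      Σ-below (suc M) = begin
        Σ[ below (suc M) ]             ≡⟨ Σ-cong (below-suc M) ⟩
        Σ[ (λ j → below M j + at M j) ] ≡⟨ Σ-+ (below M) (at M) ⟩
        Σ[ below M ] + Σ[ at M ]       ≡⟨ cong₂ _+_ (Σ-below M) (Σ-at M) ⟩
        sumBelow M Δ + Δ M             ∎

    Σ-reindex : ∀ N → (∀ j → key j ℕ.< N) → Σ[ Δ ∘ key ] ≡ sumBelow N Δ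
    Σ-reindex N key<N = trans (Σ-cong below-N) (Σ-below N)
      where
      below-N : ∀ j → Δ (key j) ≡ below N j
      below-N j with key j ℕ.<? N
      ... | yes _    = refl
      ... | no k≮N = ⊥-elim (k≮N (key<N j))

module Suprema (R : CompleteOrderedField) where
  open OrderedField R

  IsLUB-cong : ∀ {P Q : Carrier → Set} {B} → (∀ a → P a ⇔ Q a) → IsLUB _≤_ P B → IsLUB _≤_ Q B
  IsLUB-cong P⇔Q (B-upper , B-least) =
    (λ a → B-upper a ∘ Equivalence.from (P⇔Q a)) , λ b b-upper → B-least b λ a → b-upper a ∘ Equivalence.to (P⇔Q a)

  module _ {P : Carrier → Set} {B : Carrier} (B-lub : IsLUB _≤_ P B) where

    private
      B-upper : IsUpperBound _≤_ P B
      B-upper = proj₁ B-lub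

      B-least : ∀ b → IsUpperBound _≤_ P b → B ≤ b
      B-least = proj₂ B-lub

    -- B + (b − c B) bounds P, so it is at least B.
    lub-scale-nonpos : ∀ {c b} → c ≤ 0# → (∀ a → P a → c * a ≤ b) → c * B ≤ b
    lub-scale-nonpos {c} {b} c≤0 bounded = 0≤y-x⇒x≤y (≤-rearrange (- B) (-‿inverseʳ B)
        (solve 2 (λ B d → B :+ d :- B := d) refl B (b - c * B)) (B-least _ bound′))
      where
      bound′ : IsUpperBound _≤_ P (B + (b - c * B))
      bound′ a a∈P = ≤-trans (B-upper a a∈P) (subst (_≤ B + (b - c * B)) (+-identityʳ B) (+-monoʳ-≤ B
        (x≤y⇒0≤y-x (≤-trans (*-monoˡ-≤-nonpos c c≤0 (B-upper a a∈P)) (bounded a a∈P)))))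

    lub-scale-pos : ∀ k {b} → (∀ a → P a → ι (suc k) * a ≤ b) → ι (suc k) * B ≤ b
    lub-scale-pos k {b} bounded = subst (ι (suc k) * B ≤_) (ι-suc-cancel k b)
        (*-monoˡ-≤-nonneg (ι (suc k)) (ι-nonneg (suc k)) (B-least _ bound′))
      where
      bound′ : IsUpperBound _≤_ P (b * 1/[1+ k ])
      bound′ a a∈P = subst₂ _≤_ (ι⁻¹-cancel a) (*-comm 1/[1+ k ] b)
        (*-monoˡ-≤-nonneg 1/[1+ k ] (1/[1+m]-nonneg k) (bounded a a∈P))
        where
        ι⁻¹-cancel : ∀ a → 1/[1+ k ] * (ι (suc k) * a) ≡ a
        ι⁻¹-cancel a = trans (solve 3 (λ e d a → e :* (d :* a) := d :* (a :* e)) refl 1/[1+ k ] (ι (suc k)) a)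
                             (ι-suc-cancel k a)

    lub-scale : ∀ p q {b} → (∀ a → P a → (ι p - ι q) * a ≤ b) → (ι p - ι q) * B ≤ b
    lub-scale p q {b} with ℕ.compare p q
    ... | less p k    = lub-scale-nonpos (subst (_≤ 0#) (sym (ι-less p k)) (0≤x⇒-x≤0 (ι-nonneg (suc k))))
    ... | equal p     = lub-scale-nonpos (≤-reflexive (-‿inverseʳ (ι p)))
    ... | greater q k = λ bounded → subst (λ c → c * B ≤ b) (sym (ι-greater q k))
                          (lub-scale-pos k (λ a a∈P → subst (λ c → c * a ≤ b) (ι-greater q k) (bounded a a∈P)))

module LinearInequalities (R : CompleteOrderedField) {V : Set} (_≟_ : DecidableEquality V) where
  open OrderedField R
  open Suprema R using (lub-scale)
  open import Data.List.Membership.Propositional using (_∈_; _∉_)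
  open import Data.Unit using (tt) renaming (⊤ to Unit)
  open ≡-Reasoning

  data Literal : Set where
    pos neg : V → Literal

  var : Literal → V
  var (pos v) = v
  var (neg v) = v

  -- an integer combination of variables, each coefficient written as repeated ± literals
  Form : Set
  Form = List Literal

  infix 4.5 _≼_ _≲_

  record Inequality : Set where
    constructor _≼_
    field
      form  : Form
      bound : Carrier

  Assignment : Set
  Assignment = V → Carrier

  ⟦_⟧ˡ : Literal → Assignment → Carrier
  ⟦ pos v ⟧ˡ x = x v
  ⟦ neg v ⟧ˡ x = - x v

  ⟦_⟧ : Form → Assignment → Carrier
  ⟦ [] ⟧    x = 0#
  ⟦ l ∷ L ⟧ x = ⟦ l ⟧ˡ x + ⟦ L ⟧ x

  infix 4 _⊨_ _⊨*_

  _⊨_ : Assignment → Inequality → Set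
  x ⊨ (L ≼ b) = ⟦ L ⟧ x ≤ b

  _⊨*_ : Assignment → List Inequality → Set
  x ⊨* S = All (x ⊨_) S

  Over : (V → Set) → Form → Set
  Over Q = All (Q ∘ var)

  SystemOver : (V → Set) → List Inequality → Set
  SystemOver Q = All (Over Q ∘ Inequality.form)

  ⟦⟧-++ : ∀ L M x → ⟦ L ++ M ⟧ x ≡ ⟦ L ⟧ x + ⟦ M ⟧ x
  ⟦⟧-++ []      M x = sym (+-identityˡ _)
  ⟦⟧-++ (l ∷ L) M x = trans (cong (⟦ l ⟧ˡ x +_) (⟦⟧-++ L M x)) (sym (+-assoc _ _ _))

  _⊛_ : ℕ → Form → Form
  m ⊛ L = concat (replicate m L)

  ⟦⟧-⊛ : ∀ m L x → ⟦ m ⊛ L ⟧ x ≡ ι m * ⟦ L ⟧ x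
  ⟦⟧-⊛ zero    L x = sym (zeroˡ _)
  ⟦⟧-⊛ (suc m) L x = begin
    ⟦ L ++ m ⊛ L ⟧ x             ≡⟨ ⟦⟧-++ L (m ⊛ L) x ⟩
    ⟦ L ⟧ x + ⟦ m ⊛ L ⟧ x        ≡⟨ cong (⟦ L ⟧ x +_) (⟦⟧-⊛ m L x) ⟩
    ⟦ L ⟧ x + ι m * ⟦ L ⟧ x      ≡⟨ cong (_+ ι m * ⟦ L ⟧ x) (sym (*-identityˡ (⟦ L ⟧ x))) ⟩
    1# * ⟦ L ⟧ x + ι m * ⟦ L ⟧ x ≡⟨ sym (distribʳ (⟦ L ⟧ x) 1# (ι m)) ⟩
    (1# + ι m) * ⟦ L ⟧ x         ∎

  Over-⊛ : ∀ {Q} m {L} → Over Q L → Over Q (m ⊛ L)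
  Over-⊛ zero    _   = []
  Over-⊛ {Q} (suc m) Q-L = All.++⁺ Q-L (Over-⊛ {Q} m Q-L)

  ⟦⟧-cong : ∀ {Q x y} → (∀ {v} → Q v → x v ≡ y v) → ∀ {L} → Over Q L → ⟦ L ⟧ x ≡ ⟦ L ⟧ y
  ⟦⟧-cong x≗y {[]}        []           = refl
  ⟦⟧-cong x≗y {pos v ∷ L} (Q-v ∷ Q-L) = cong₂ _+_ (x≗y Q-v) (⟦⟧-cong x≗y Q-L)
  ⟦⟧-cong x≗y {neg v ∷ L} (Q-v ∷ Q-L) = cong₂ _+_ (cong -_ (x≗y Q-v)) (⟦⟧-cong x≗y Q-L)

  negate : Form → Form
  negate []          = []
  negate (pos v ∷ L) = neg v ∷ negate L
  negate (neg v ∷ L) = pos v ∷ negate L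

  ⟦⟧-negate : ∀ L x → ⟦ negate L ⟧ x ≡ - ⟦ L ⟧ x
  ⟦⟧-negate []          x = sym -0#≈0#
  ⟦⟧-negate (pos v ∷ L) x = trans (cong (- x v +_) (⟦⟧-negate L x)) (-‿+-comm (x v) (⟦ L ⟧ x))
  ⟦⟧-negate (neg v ∷ L) x = trans (cong₂ _+_ (sym (-‿involutive (x v))) (⟦⟧-negate L x)) (-‿+-comm (- x v) (⟦ L ⟧ x))

  _≲_ : Form → Form → Inequality
  L ≲ M = L ++ negate M ≼ 0#

  ⊨-≲ : ∀ x L M → x ⊨ L ≲ M ⇔ ⟦ L ⟧ x ≤ ⟦ M ⟧ x
  ⊨-≲ x L M = mk⇔ (x-y≤0⇒x≤y ∘ subst (_≤ 0#) ⟦L-M⟧) (subst (_≤ 0#) (sym ⟦L-M⟧) ∘ x≤y⇒x-y≤0)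
    where
    ⟦L-M⟧ : ⟦ L ++ negate M ⟧ x ≡ ⟦ L ⟧ x - ⟦ M ⟧ x
    ⟦L-M⟧ = trans (⟦⟧-++ L (negate M) x) (cong (⟦ L ⟧ x +_) (⟦⟧-negate M x))

  infixl 9 _[_≔_]

  _[_≔_] : Assignment → V → Carrier → Assignment
  (x [ v ≔ a ]) w with w ≟ v
  ... | yes _ = a
  ... | no _  = x w

  [≔]-same : ∀ x v a → (x [ v ≔ a ]) v ≡ a
  [≔]-same x v a with v ≟ v
  ... | yes _  = refl
  ... | no v≢v = ⊥-elim (v≢v refl)

  [≔]-other : ∀ x {v w} a → w ≢ v → (x [ v ≔ a ]) w ≡ x w
  [≔]-other x {v} {w} a w≢v with w ≟ v
  ... | yes w≡v = ⊥-elim (w≢v w≡v)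
  ... | no _    = refl

  module FourierMotzkin (v₀ : V) where

    Split : Set
    Split = ℕ × ℕ × Form

    ⟦_⟧ˢ : Split → Assignment → Carrier
    ⟦ p , q , r ⟧ˢ x = (ι p - ι q) * x v₀ + ⟦ r ⟧ x

    push : Literal → Split → Split
    push (pos v) (p , q , r) with v ≟ v₀
    ... | yes _ = suc p , q , r
    ... | no _  = p , q , pos v ∷ r
    push (neg v) (p , q , r) with v ≟ v₀
    ... | yes _ = p , suc q , r
    ... | no _  = p , q , neg v ∷ r

    split : Form → Split
    split []      = 0 , 0 , []
    split (l ∷ L) = push l (split L)

    ⟦⟧-push : ∀ l s x → ⟦ l ⟧ˡ x + ⟦ s ⟧ˢ x ≡ ⟦ push l s ⟧ˢ x
    ⟦⟧-push (pos v) (p , q , r) x with v ≟ v₀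
    ... | yes refl = trans (cong (_+ ⟦ p , q , r ⟧ˢ x) (sym (*-identityˡ (x v))))
      (solve 5 (λ o a p q r → o :* a :+ ((p :- q) :* a :+ r) := (o :+ p :- q) :* a :+ r) refl 1# (x v) (ι p) (ι q) (⟦ r ⟧ x))
    ... | no _     =
      solve 4 (λ a b c d → b :+ (c :* a :+ d) := c :* a :+ (b :+ d)) refl (x v₀) (x v) (ι p - ι q) (⟦ r ⟧ x)
    ⟦⟧-push (neg v) (p , q , r) x with v ≟ v₀
    ... | yes refl = trans (cong (λ z → - z + ⟦ p , q , r ⟧ˢ x) (sym (*-identityˡ (x v))))
      (solve 5 (λ o a p q r → :- (o :* a) :+ ((p :- q) :* a :+ r) := (p :- (o :+ q)) :* a :+ r) refl 1# (x v) (ι p) (ι q) (⟦ r ⟧ x))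
    ... | no _     =
      solve 4 (λ a b c d → :- b :+ (c :* a :+ d) := c :* a :+ (:- b :+ d)) refl (x v₀) (x v) (ι p - ι q) (⟦ r ⟧ x)

    ⟦⟧-split : ∀ L x → ⟦ L ⟧ x ≡ ⟦ split L ⟧ˢ x
    ⟦⟧-split []      x = solve 2 (λ a z → z := (z :- z) :* a :+ z) refl (x v₀) 0#
    ⟦⟧-split (l ∷ L) x = trans (cong (⟦ l ⟧ˡ x +_) (⟦⟧-split L x)) (⟦⟧-push l (split L) x)

    rest : Form → Form
    rest L = proj₂ (proj₂ (split L))

    Avoiding : (V → Set) → V → Set
    Avoiding Q v = Q v × v ≢ v₀

    Over-push : ∀ {Q} l s → Q (var l) → Over (Avoiding Q) (proj₂ (proj₂ s)) → Over (Avoiding Q) (proj₂ (proj₂ (push l s)))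
    Over-push (pos v) (p , q , r) Q-v Q-r with v ≟ v₀
    ... | yes _  = Q-r
    ... | no v≢v₀ = (Q-v , v≢v₀) ∷ Q-r
    Over-push (neg v) (p , q , r) Q-v Q-r with v ≟ v₀
    ... | yes _  = Q-r
    ... | no v≢v₀ = (Q-v , v≢v₀) ∷ Q-r

    Over-rest : ∀ {Q L} → Over Q L → Over (Avoiding Q) (rest L)
    Over-rest {L = []}    []          = []
    Over-rest {Q} {L = l ∷ L} (Q-l ∷ Q-L) = Over-push {Q} l (split L) Q-l (Over-rest {Q} Q-L)

    ⟦⟧-univariate : ∀ {L} → Over (_≡ v₀) L → ∀ x →
                    ⟦ L ⟧ x ≡ (ι (proj₁ (split L)) - ι (proj₁ (proj₂ (split L)))) * x v₀
    ⟦⟧-univariate {L} v₀-L x = trans (⟦⟧-split L x)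
        (trans (cong (λ r → c * x v₀ + ⟦ r ⟧ x) (no-rest (Over-rest {_≡ v₀} v₀-L))) (+-identityʳ _))
      where
      c : Carrier
      c = ι (proj₁ (split L)) - ι (proj₁ (proj₂ (split L)))
      no-rest : ∀ {r} → Over (Avoiding (_≡ v₀)) r → r ≡ []
      no-rest []                    = refl
      no-rest ((v≡v₀ , v≢v₀) ∷ _) = ⊥-elim (v≢v₀ v≡v₀)

    -- bound k r b  stands for  −(1+k)·v₀ + r ≤ b  as a lower bound
    -- and for  (1+k)·v₀ + r ≤ b  as an upper bound on v₀
    record Bound : Set where
      constructor bound
      field
        weight : ℕ
        form   : Form
        const  : Carrier

    data Kind : Set where
      free        : Inequality → Kind
      lower upper : Bound → Kind

    Lift : (Inequality → Set) → (Bound → Set) → (Bound → Set) → Kind → Set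
    Lift P Pˡ Pᵘ (free i)  = P i
    Lift P Pˡ Pᵘ (lower l) = Pˡ l
    Lift P Pˡ Pᵘ (upper u) = Pᵘ u

    infix 4 _⊨ˡ_ _⊨ᵘ_ _⊨ᵏ_

    _⊨ˡ_ _⊨ᵘ_ : Assignment → Bound → Set
    x ⊨ˡ bound k r b = - (ι (suc k) * x v₀) + ⟦ r ⟧ x ≤ b
    x ⊨ᵘ bound k r b = ι (suc k) * x v₀ + ⟦ r ⟧ x ≤ b

    _⊨ᵏ_ : Assignment → Kind → Set
    x ⊨ᵏ k = Lift (x ⊨_) (x ⊨ˡ_) (x ⊨ᵘ_) k

    KindOver : (V → Set) → Kind → Set
    KindOver Q = Lift (Over Q ∘ Inequality.form) (Over Q ∘ Bound.form) (Over Q ∘ Bound.form)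

    kind : Split → Carrier → Kind
    kind (p , q , r) b with ℕ.compare p q
    ... | less _ k    = lower (bound k r b)
    ... | equal _     = free (r ≼ b)
    ... | greater _ k = upper (bound k r b)

    ⊨-kind : ∀ x s b → ⟦ s ⟧ˢ x ≤ b ⇔ x ⊨ᵏ kind s b
    ⊨-kind x (p , q , r) b with ℕ.compare p q
    ... | less p k    = ≤-cong (cong (_+ ⟦ r ⟧ x) (trans (cong (_* x v₀) (ι-less p k)) (sym (-‿distribˡ-* _ _))))
    ... | equal p     = ≤-cong (solve 3 (λ p a r → (p :- p) :* a :+ r := r) refl (ι p) (x v₀) (⟦ r ⟧ x))
    ... | greater q k = ≤-cong (cong (λ c → c * x v₀ + ⟦ r ⟧ x) (ι-greater q k))

    KindOver-kind : ∀ {Q} s b → Over Q (proj₂ (proj₂ s)) → KindOver Q (kind s b)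
    KindOver-kind (p , q , r) b Q-r with ℕ.compare p q
    ... | less _ k    = Q-r
    ... | equal _     = Q-r
    ... | greater _ k = Q-r

    classify : Inequality → Kind
    classify (L ≼ b) = kind (split L) b

    ⊨-classify : ∀ x i → x ⊨ i ⇔ x ⊨ᵏ classify i
    ⊨-classify x (L ≼ b) = ⊨-kind x (split L) b ⇔-∘ ≤-cong (⟦⟧-split L x)

    KindOver-classify : ∀ {Q} i → Over Q (Inequality.form i) → KindOver (Avoiding Q) (classify i)
    KindOver-classify {Q} (L ≼ b) Q-L = KindOver-kind {Avoiding Q} (split L) b (Over-rest {Q} Q-L)

    frees : List Kind → List Inequality
    frees []             = []
    frees (free i  ∷ ks) = i ∷ frees ks
    frees (lower _ ∷ ks) = frees ks
    frees (upper _ ∷ ks) = frees ks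

    lowers uppers : List Kind → List Bound
    lowers []             = []
    lowers (free _  ∷ ks) = lowers ks
    lowers (lower l ∷ ks) = l ∷ lowers ks
    lowers (upper _ ∷ ks) = lowers ks
    uppers []             = []
    uppers (free _  ∷ ks) = uppers ks
    uppers (lower _ ∷ ks) = uppers ks
    uppers (upper u ∷ ks) = u ∷ uppers ks

    module _ (P : Inequality → Set) (Pˡ Pᵘ : Bound → Set) where

      partition⁺ : ∀ ks → All (Lift P Pˡ Pᵘ) ks → All P (frees ks) × All Pˡ (lowers ks) × All Pᵘ (uppers ks)
      partition⁺ []             []         = [] , [] , []
      partition⁺ (free _  ∷ ks) (p ∷ ps) = let f , l , u = partition⁺ ks ps in p ∷ f , l , u
      partition⁺ (lower _ ∷ ks) (p ∷ ps) = let f , l , u = partition⁺ ks ps in f , p ∷ l , u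
      partition⁺ (upper _ ∷ ks) (p ∷ ps) = let f , l , u = partition⁺ ks ps in f , l , p ∷ u

      partition⁻ : ∀ ks → All P (frees ks) → All Pˡ (lowers ks) → All Pᵘ (uppers ks) → All (Lift P Pˡ Pᵘ) ks
      partition⁻ []             _        _        _        = []
      partition⁻ (free _  ∷ ks) (p ∷ f) l        u        = p ∷ partition⁻ ks f l u
      partition⁻ (lower _ ∷ ks) f        (p ∷ l) u        = p ∷ partition⁻ ks f l u
      partition⁻ (upper _ ∷ ks) f        l        (p ∷ u) = p ∷ partition⁻ ks f l u

    -- (1+kᵘ)·(lower bound) + (1+kˡ)·(upper bound): the multiples of v₀ cancel
    combine : Bound → Bound → Inequality
    combine (bound kˡ rˡ bˡ) (bound kᵘ rᵘ bᵘ) =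
      (suc kᵘ ⊛ rˡ ++ suc kˡ ⊛ rᵘ) ≼ (ι (suc kᵘ) * bˡ + ι (suc kˡ) * bᵘ)

    eliminate : List Inequality → List Inequality
    eliminate S = frees ks ++ cartesianProductWith combine (lowers ks) (uppers ks)
      where ks = map classify S

    ⟦⟧-combine : ∀ kˡ rˡ kᵘ rᵘ x →
                 ⟦ suc kᵘ ⊛ rˡ ++ suc kˡ ⊛ rᵘ ⟧ x ≡ ι (suc kᵘ) * ⟦ rˡ ⟧ x + ι (suc kˡ) * ⟦ rᵘ ⟧ x
    ⟦⟧-combine kˡ rˡ kᵘ rᵘ x = trans (⟦⟧-++ (suc kᵘ ⊛ rˡ) (suc kˡ ⊛ rᵘ) x)
                                     (cong₂ _+_ (⟦⟧-⊛ (suc kᵘ) rˡ x) (⟦⟧-⊛ (suc kˡ) rᵘ x))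

    combine-sound : ∀ {x} l u → x ⊨ˡ l → x ⊨ᵘ u → x ⊨ combine l u
    combine-sound {x} (bound kˡ rˡ bˡ) (bound kᵘ rᵘ bᵘ) x⊨l x⊨u = subst (_≤ _) (sym (trans (⟦⟧-combine kˡ rˡ kᵘ rᵘ x)
        (solve 5 (λ c d a p q → c :* p :+ d :* q := c :* (:- (d :* a) :+ p) :+ d :* (c :* a :+ q))
               refl Cᵘ Cˡ (x v₀) (⟦ rˡ ⟧ x) (⟦ rᵘ ⟧ x))))
      (+-mono₂-≤ (*-monoˡ-≤-nonneg Cᵘ (ι-nonneg (suc kᵘ)) x⊨l) (*-monoˡ-≤-nonneg Cˡ (ι-nonneg (suc kˡ)) x⊨u))
      where Cˡ = ι (suc kˡ) ; Cᵘ = ι (suc kᵘ)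

    lowerValue upperValue : Assignment → Bound → Carrier
    lowerValue x (bound k r b) = (⟦ r ⟧ x - b) * 1/[1+ k ]
    upperValue x (bound k r b) = (b - ⟦ r ⟧ x) * 1/[1+ k ]

    lowerValue≤⇒⊨ˡ : ∀ x l → lowerValue x l ≤ x v₀ → x ⊨ˡ l
    lowerValue≤⇒⊨ˡ x (bound k r b) l≤x = ≤-rearrange (b - D * x v₀)
      (solve 3 (λ r b d → r :- b :+ (b :- d) := :- d :+ r) refl (⟦ r ⟧ x) b (D * x v₀))
      (solve 2 (λ b d → d :+ (b :- d) := b) refl b (D * x v₀))
      (subst (_≤ D * x v₀) (ι-suc-cancel k _) (*-monoˡ-≤-nonneg D (ι-nonneg (suc k)) l≤x))
      where D = ι (suc k)

    ≤upperValue⇒⊨ᵘ : ∀ x u → x v₀ ≤ upperValue x u → x ⊨ᵘ u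
    ≤upperValue⇒⊨ᵘ x (bound k r b) x≤u = ≤-rearrange (⟦ r ⟧ x) refl
      (solve 2 (λ b r → b :- r :+ r := b) refl b (⟦ r ⟧ x))
      (subst (D * x v₀ ≤_) (ι-suc-cancel k _) (*-monoˡ-≤-nonneg D (ι-nonneg (suc k)) x≤u))
      where D = ι (suc k)

    ⊨combine⇒lowerValue≤upperValue : ∀ x l u → x ⊨ combine l u → lowerValue x l ≤ upperValue x u
    ⊨combine⇒lowerValue≤upperValue x (bound kˡ rˡ bˡ) (bound kᵘ rᵘ bᵘ) x⊨c = subst₂ _≤_
        (cancel kᵘ 1/[1+ kˡ ] (a - bˡ))
        (trans (cong (_* (Cˡ * (bᵘ - c))) (*-comm 1/[1+ kˡ ] 1/[1+ kᵘ ])) (cancel kˡ 1/[1+ kᵘ ] (bᵘ - c)))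
        (*-monoˡ-≤-nonneg (1/[1+ kˡ ] * 1/[1+ kᵘ ]) (*-nonneg (1/[1+m]-nonneg kˡ) (1/[1+m]-nonneg kᵘ)) separated)
      where
      Cˡ = ι (suc kˡ) ; Cᵘ = ι (suc kᵘ) ; a = ⟦ rˡ ⟧ x ; c = ⟦ rᵘ ⟧ x
      separated : Cᵘ * (a - bˡ) ≤ Cˡ * (bᵘ - c)
      separated = ≤-rearrange (- (Cᵘ * bˡ) - Cˡ * c)
        (solve 6 (λ C D a c p q → C :* a :+ D :* c :+ (:- (C :* p) :- D :* c) := C :* (a :- p)) refl Cᵘ Cˡ a c bˡ bᵘ)
        (solve 6 (λ C D a c p q → C :* p :+ D :* q :+ (:- (C :* p) :- D :* c) := D :* (q :- c)) refl Cᵘ Cˡ a c bˡ bᵘ)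
        (subst (_≤ _) (⟦⟧-combine kˡ rˡ kᵘ rᵘ x) x⊨c)
      cancel : ∀ k e z → e * 1/[1+ k ] * (ι (suc k) * z) ≡ z * e
      cancel k e z = trans (solve 4 (λ e f d z → e :* f :* (d :* z) := d :* f :* (z :* e)) refl e 1/[1+ k ] (ι (suc k)) z)
        (trans (cong (_* (z * e)) (ι*1/[1+m]≡1 k)) (*-identityˡ (z * e)))

    eliminate-sound : ∀ {x} S → x ⊨* S → x ⊨* eliminate S
    eliminate-sound {x} S x⊨S =
      let x⊨frees , x⊨lowers , x⊨uppers = partition⁺ (x ⊨_) (x ⊨ˡ_) (x ⊨ᵘ_) ks x⊨ks
      in All.++⁺ x⊨frees (All.cartesianProductWith⁺ (setoid _) (setoid _) combine (lowers ks) (uppers ks)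
           λ {l} {u} l∈ u∈ → combine-sound l u (All.lookup x⊨lowers l∈) (All.lookup x⊨uppers u∈))
      where
      ks = map classify S
      x⊨ks : All (x ⊨ᵏ_) ks
      x⊨ks = All.map⁺ (All.map (λ {i} → Equivalence.to (⊨-classify x i)) x⊨S)

    eliminate-over : ∀ {Q} S → SystemOver Q S → SystemOver (Avoiding Q) (eliminate S)
    eliminate-over {Q} S Q-S =
      let Q-frees , Q-lowers , Q-uppers = partition⁺ (Over Q′ ∘ Inequality.form) (Over Q′ ∘ Bound.form)
                                                     (Over Q′ ∘ Bound.form) ks Q-ks
      in All.++⁺ Q-frees (All.cartesianProductWith⁺ (setoid _) (setoid _) combine (lowers ks) (uppers ks)
           λ {l} {u} l∈ u∈ → Over-combine l u (All.lookup Q-lowers l∈) (All.lookup Q-uppers u∈))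
      where
      Q′ = Avoiding Q
      ks = map classify S
      Q-ks : All (KindOver Q′) ks
      Q-ks = All.map⁺ (All.map (λ {i} → KindOver-classify {Q} i) Q-S)
      Over-combine : ∀ l u → Over Q′ (Bound.form l) → Over Q′ (Bound.form u) → Over Q′ (Inequality.form (combine l u))
      Over-combine (bound kˡ rˡ bˡ) (bound kᵘ rᵘ bᵘ) Q-rˡ Q-rᵘ =
        All.++⁺ (Over-⊛ {Q′} (suc kᵘ) Q-rˡ) (Over-⊛ {Q′} (suc kˡ) Q-rᵘ)

    eliminate-complete : ∀ {x} S → x ⊨* eliminate S → ∃[ a ] x [ v₀ ≔ a ] ⊨* S
    eliminate-complete {x} S x⊨S′ = a , All.map (λ {i} → Equivalence.from (⊨-classify x′ i)) (All.map⁻ x′⊨ks)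
      where
      ks = map classify S
      ls = lowers ks
      us = uppers ks
      Q′ = Avoiding (λ _ → Unit)
      over : All (Over Q′ ∘ Inequality.form) (frees ks) × All (Over Q′ ∘ Bound.form) ls × All (Over Q′ ∘ Bound.form) us
      over = partition⁺ (Over Q′ ∘ Inequality.form) (Over Q′ ∘ Bound.form) (Over Q′ ∘ Bound.form) ks
        (All.map⁺ (All.map (λ {i} → KindOver-classify {λ _ → Unit} i) (All.tabulate λ _ → All.tabulate λ _ → tt)))

      separated : ∀ {l u} → l ∈ ls → u ∈ us → lowerValue x l ≤ upperValue x u
      separated {l} {u} l∈ u∈ = ⊨combine⇒lowerValue≤upperValue x l u
        (All.lookup (All.++⁻ʳ (frees ks) x⊨S′) (∈-cartesianProductWith⁺ combine l∈ u∈))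

      between : ∃[ a ] All (λ l → lowerValue x l ≤ a) ls × All (λ u → a ≤ upperValue x u) us
      between = ∃-between (lowerValue x) (upperValue x) ls us separated

      a : Carrier
      a = proj₁ between

      x′ : Assignment
      x′ = x [ v₀ ≔ a ]
      x′≗x : ∀ {v} → Q′ v → x′ v ≡ x v
      x′≗x (_ , v≢v₀) = [≔]-other x a v≢v₀

      free-holds : ∀ i → Over Q′ (Inequality.form i) → x ⊨ i → x′ ⊨ i
      free-holds (L ≼ b) Q′-L = subst (_≤ b) (sym (⟦⟧-cong x′≗x Q′-L))

      lower-holds : ∀ l → Over Q′ (Bound.form l) → lowerValue x l ≤ a → x′ ⊨ˡ l
      lower-holds (bound k r b) Q′-r l≤a = lowerValue≤⇒⊨ˡ x′ (bound k r b)
        (subst₂ (λ z w → (z - b) * 1/[1+ k ] ≤ w) (sym (⟦⟧-cong x′≗x Q′-r)) (sym ([≔]-same x v₀ a)) l≤a)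

      upper-holds : ∀ u → Over Q′ (Bound.form u) → a ≤ upperValue x u → x′ ⊨ᵘ u
      upper-holds (bound k r b) Q′-r a≤u = ≤upperValue⇒⊨ᵘ x′ (bound k r b)
        (subst₂ (λ z w → w ≤ (b - z) * 1/[1+ k ]) (sym (⟦⟧-cong x′≗x Q′-r)) (sym ([≔]-same x v₀ a)) a≤u)

      x′⊨ks : All (x′ ⊨ᵏ_) ks
      x′⊨ks = partition⁻ (x′ ⊨_) (x′ ⊨ˡ_) (x′ ⊨ᵘ_) ks
        (All.tabulate λ {i} i∈ → free-holds i (All.lookup (proj₁ over) i∈) (All.lookup (All.++⁻ˡ (frees ks) x⊨S′) i∈))
        (All.tabulate λ {l} l∈ → lower-holds l (All.lookup (proj₁ (proj₂ over)) l∈) (All.lookup (proj₁ (proj₂ between)) l∈))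
        (All.tabulate λ {u} u∈ → upper-holds u (All.lookup (proj₂ (proj₂ over)) u∈) (All.lookup (proj₂ (proj₂ between)) u∈))

  open FourierMotzkin using (eliminate; eliminate-sound; eliminate-complete; eliminate-over; ⟦⟧-univariate)

  eliminateAll : List V → List Inequality → List Inequality
  eliminateAll []       S = S
  eliminateAll (v ∷ vs) S = eliminateAll vs (eliminate v S)

  eliminateAll-sound : ∀ vs {x} S → x ⊨* S → x ⊨* eliminateAll vs S
  eliminateAll-sound []       S x⊨S = x⊨S
  eliminateAll-sound (v ∷ vs) S x⊨S = eliminateAll-sound vs (eliminate v S) (eliminate-sound v S x⊨S)

  eliminateAll-complete : ∀ vs {t x} S → t ∉ vs → x ⊨* eliminateAll vs S → Σ Assignment λ x′ → x′ ⊨* S × x′ t ≡ x t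
  eliminateAll-complete []       S _    x⊨S′ = _ , x⊨S′ , refl
  eliminateAll-complete (v ∷ vs) {t} S t∉v∷vs x⊨S′ =
    let x₁ , x₁⊨S₁ , x₁t≡xt = eliminateAll-complete vs (eliminate v S) (t∉v∷vs ∘ there) x⊨S′
        a , x₂⊨S = eliminate-complete v S x₁⊨S₁
    in x₁ [ v ≔ a ] , x₂⊨S , trans ([≔]-other x₁ a (t∉v∷vs ∘ here)) x₁t≡xt

  eliminateAll-over : ∀ vs {Q} S → SystemOver Q S → SystemOver (λ v → Q v × v ∉ vs) (eliminateAll vs S)
  eliminateAll-over []       {Q} S Q-S = All.map (All.map {P = Q ∘ var} (_, λ ())) Q-S
  eliminateAll-over (v ∷ vs) {Q} S Q-S = All.map (All.map {P = λ l → (Q (var l) × var l ≢ v) × var l ∉ vs} move)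
      (eliminateAll-over vs {FourierMotzkin.Avoiding v Q} (eliminate v S) (eliminate-over v {Q} S Q-S))
    where
    move : ∀ {w} → (Q w × w ≢ v) × w ∉ vs → Q w × w ∉ v ∷ vs
    move ((Q-w , w≢v) , w∉vs) = Q-w , λ { (here w≡v) → w≢v w≡v ; (there w∈vs) → w∉vs w∈vs }

  Feasible : List Inequality → V → Carrier → Set
  Feasible S t a = Σ Assignment λ x → x ⊨* S × x t ≡ a

  supremum-attained : (vars : List V) → (∀ v → v ∈ vars) →
                      ∀ S t {B} → IsLUB _≤_ (Feasible S t) B → Feasible S t B
  supremum-attained vars vars-complete S t {B} B-lub =
    eliminateAll-complete others S t∉others (All.tabulate λ {i} i∈S′ → B-satisfies i (All.lookup only-t i∈S′) i∈S′)
    where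
    others : List V
    others = filter (λ v → ¬? (v ≟ t)) vars

    S′ : List Inequality
    S′ = eliminateAll others S

    t∉others : t ∉ others
    t∉others t∈others = All.lookup (All.all-filter (λ v → ¬? (v ≟ t)) vars) t∈others refl

    only-t : SystemOver (_≡ t) S′
    only-t = All.map (All.map λ {v} → only) (eliminateAll-over others S (All.tabulate λ _ → All.tabulate λ _ → tt))
      where
      only : ∀ {v} → Unit × v ∉ others → v ≡ t
      only {v} (_ , v∉others) with v ≟ t
      ... | yes v≡t = v≡t
      ... | no v≢t  = ⊥-elim (v∉others (∈-filter⁺ (λ v → ¬? (v ≟ t)) (vars-complete v) v≢t))

    B-satisfies : ∀ i → Over (_≡ t) (Inequality.form i) → i ∈ S′ → (λ _ → B) ⊨ i
    B-satisfies (L ≼ b) t-L i∈S′ = subst (_≤ b) (sym (⟦⟧-univariate t t-L _))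
      (lub-scale B-lub p q λ where
        a (x , x⊨S , xt≡a) → subst (λ z → (ι p - ι q) * z ≤ b) xt≡a
          (subst (_≤ b) (⟦⟧-univariate t t-L x) (All.lookup (eliminateAll-sound others S x⊨S) i∈S′)))
      where
      p q : ℕ
      p = proj₁ (FourierMotzkin.split t L)
      q = proj₁ (proj₂ (FourierMotzkin.split t L))

⊆⇒∪≡ : ∀ {n} {X Y : Subset n} → X ⊆ Y → X ∪ Y ≡ Y
⊆⇒∪≡ {X = X} {Y} X⊆Y = ⊆-antisym (λ m → [ X⊆Y , id ]′ (x∈p∪q⁻ X Y m)) (q⊆p∪q X Y)

allSubsets : ∀ m → List (Subset m)
allSubsets zero    = []ᵥ ∷ []
allSubsets (suc m) = map (true ∷ᵥ_) (allSubsets m) ++ map (false ∷ᵥ_) (allSubsets m)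

∈-allSubsets : ∀ {m} (X : Subset m) → X List.∈ allSubsets m
∈-allSubsets []ᵥ          = here refl
∈-allSubsets (true ∷ᵥ X)  = ∈-++⁺ˡ (∈-map⁺ (true ∷ᵥ_) (∈-allSubsets X))
∈-allSubsets (false ∷ᵥ X) = ∈-++⁺ʳ (map (true ∷ᵥ_) (allSubsets _)) (∈-map⁺ (false ∷ᵥ_) (∈-allSubsets X))

subsetOf : ∀ {n} {P : Fin n → Set} → (∀ u → Dec (P u)) → Subset n
subsetOf P? = Vec.tabulate (does ∘ P?)

module _ {n} {P : Fin n → Set} (P? : ∀ u → Dec (P u)) where
  open import Data.Fin.Subset using (_∈_)

  ∈-subsetOf⁺ : ∀ {u} → P u → u ∈ subsetOf P?
  ∈-subsetOf⁺ {u} Pu = Vecₚ.lookup⇒[]= u _ (trans (Vecₚ.lookup∘tabulate (does ∘ P?) u) (dec-true (P? u) Pu))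

  ∈-subsetOf⁻ : ∀ {u} → u ∈ subsetOf P? → P u
  ∈-subsetOf⁻ {u} u∈ with P? u | trans (sym (Vecₚ.lookup∘tabulate (does ∘ P?) u)) (Vecₚ.[]=⇒lookup u∈)
  ... | yes Pu | _ = Pu
  ... | no _   | ()

module Polymatroids (R : CompleteOrderedField) {n : ℕ} where
  open OrderedField R
  open FiniteSums R using (Σ[_]; Σ-zero; Σ-mono-≤; Σ-+)
  private
    module ∪-Solver = LatticeSolver (∪-idempotentCommutativeMonoid n)
    module ∩-Solver = LatticeSolver (∩-idempotentCommutativeMonoid n)

  IsPolymatroid⇒IsPolymatroidOn : ∀ {U : Subset n} {f} → IsPolymatroid R f → IsPolymatroidOn R U f
  IsPolymatroid⇒IsPolymatroidOn f-poly = record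
    { empty      = empty
    ; nonneg     = λ X _ → nonneg X ⊆⊤
    ; monotone   = λ X Y _ _ → monotone X Y ⊆⊤ ⊆⊤
    ; submodular = λ X Y _ _ → submodular X Y ⊆⊤ ⊆⊤ }
    where open IsPolymatroidOn f-poly

  contract : (Subset n → Carrier) → Subset n → Subset n → Carrier
  contract g P S = g (P ∪ S) - g P

  module _ {g : Subset n → Carrier} (g-poly : IsPolymatroid R g) where
    open IsPolymatroidOn g-poly

    IsPolymatroid-mono : ∀ {X Y} → X ⊆ Y → g X ≤ g Y
    IsPolymatroid-mono {X} {Y} = monotone X Y ⊆⊤ ⊆⊤

    IsPolymatroid-contract : ∀ P → IsPolymatroid R (contract g P)
    IsPolymatroid-contract P = record
      { empty      = trans (cong (λ S → g S - g P) (∪-identityʳ P)) (-‿inverseʳ (g P))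
      ; nonneg     = λ S _ → x≤y⇒0≤y-x (IsPolymatroid-mono (p⊆p∪q S))
      ; monotone   = λ X Y _ _ X⊆Y → +-mono-≤ (- g P)
                       (IsPolymatroid-mono λ m → x∈p∪q⁺ ([ inj₁ , inj₂ ∘ X⊆Y ]′ (x∈p∪q⁻ P X m)))
      ; submodular = λ X Y _ _ → ≤-rearrange (- g P - g P)
          (solve 3 (λ a b p → a :+ b :+ (:- p :- p) := (a :- p) :+ (b :- p)) refl _ _ (g P))
          (solve 3 (λ a b p → a :+ b :+ (:- p :- p) := (a :- p) :+ (b :- p)) refl _ _ (g P))
          (subst₂ (λ A B → g A + g B ≤ g (P ∪ X) + g (P ∪ Y))
            (∪-Solver.solve 3 (λ P X Y → (P ⊕ X) ⊕ (P ⊕ Y) ⊜ P ⊕ (X ⊕ Y)) refl P X Y)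
            (sym (∪-distribˡ-∩ P X Y))
            (submodular (P ∪ X) (P ∪ Y) ⊆⊤ ⊆⊤))
      }
      where open ∪-Solver using (_⊕_; _⊜_)

    IsPolymatroid-restrict : ∀ U → IsPolymatroid R (λ X → g (X ∩ U))
    IsPolymatroid-restrict U = record
      { empty      = trans (cong g (∩-zeroˡ U)) empty
      ; nonneg     = λ X _ → nonneg (X ∩ U) ⊆⊤
      ; monotone   = λ X Y _ _ X⊆Y → IsPolymatroid-mono λ m → let m∈X , m∈U = x∈p∩q⁻ X U m in x∈p∩q⁺ (X⊆Y m∈X , m∈U)
      ; submodular = λ X Y _ _ → subst₂ (λ A B → g A + g B ≤ g (X ∩ U) + g (Y ∩ U))
          (sym (∩-distribʳ-∪ U X Y))
          (∩-Solver.solve 3 (λ X Y U → (X ⊕ U) ⊕ (Y ⊕ U) ⊜ (X ⊕ Y) ⊕ U) refl X Y U)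
          (submodular (X ∩ U) (Y ∩ U) ⊆⊤ ⊆⊤)
      }
      where open ∩-Solver using (_⊕_; _⊜_)

  IsPolymatroid-Σ : ∀ {h} {g : Fin h → Subset n → Carrier} → (∀ j → IsPolymatroid R (g j)) →
                    IsPolymatroid R (λ X → Σ[ (λ j → g j X) ])
  IsPolymatroid-Σ {h} {g} g-poly = record
    { empty      = Σ-zero λ j → empty (g-poly j)
    ; nonneg     = λ X _ → subst (_≤ Σ[ (λ j → g j X) ]) (Σ-zero {h} {λ _ → 0#} λ _ → refl)
                                   (Σ-mono-≤ λ j → nonneg (g-poly j) X ⊆⊤)
    ; monotone   = λ X Y _ _ X⊆Y → Σ-mono-≤ λ j → monotone (g-poly j) X Y ⊆⊤ ⊆⊤ X⊆Y
    ; submodular = λ X Y _ _ → subst₂ _≤_ (Σ-+ (λ j → g j (X ∪ Y)) (λ j → g j (X ∩ Y))) (Σ-+ (λ j → g j X) (λ j → g j Y))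
        (Σ-mono-≤ λ j → submodular (g-poly j) X Y ⊆⊤ ⊆⊤)
    }
    where open IsPolymatroidOn

module PolymatroidProgram (R : CompleteOrderedField) (n : ℕ) where
  open OrderedField R
  open Suprema R using (IsLUB-cong)
  open LinearInequalities R {Subset n} (Vecₚ.≡-dec Bool._≟_)

  ⟨_⟩ : Subset n → Form
  ⟨ X ⟩ = pos X ∷ []

  infix 5 _⊕_

  _⊕_ : Subset n → Subset n → Form
  X ⊕ Y = pos X ∷ pos Y ∷ []

  ⟦⟨⟩⟧ : ∀ X x → ⟦ ⟨ X ⟩ ⟧ x ≡ x X
  ⟦⟨⟩⟧ X x = +-identityʳ (x X)

  ⟦⊕⟧ : ∀ X Y x → ⟦ X ⊕ Y ⟧ x ≡ x X + x Y
  ⟦⊕⟧ X Y x = cong (x X +_) (+-identityʳ (x Y))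

  subsets : List (Subset n)
  subsets = allSubsets n

  emptyAxioms : List Inequality
  emptyAxioms = (⟨ ⊥ ⟩ ≲ []) ∷ ([] ≲ ⟨ ⊥ ⟩) ∷ []

  nonnegAxiom : Subset n → Inequality
  nonnegAxiom X = [] ≲ ⟨ X ⟩

  -- monotonicity is imposed in the equivalent form h(X) ≤ h(X ∪ Y)
  monotoneAxiom submodularAxiom : Subset n → Subset n → Inequality
  monotoneAxiom X Y = ⟨ X ⟩ ≲ ⟨ X ∪ Y ⟩
  submodularAxiom X Y = X ∪ Y ⊕ X ∩ Y ≲ X ⊕ Y

  polymatroidAxioms : List Inequality
  polymatroidAxioms = emptyAxioms ++ map nonnegAxiom subsets ++ cartesianProductWith monotoneAxiom subsets subsets
                                  ++ cartesianProductWith submodularAxiom subsets subsets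

  constraintInequality : DiffConstraint R n → Inequality
  constraintInequality dc = pos Y ∷ neg X ∷ [] ≼ c
    where open DiffConstraint dc

  system : ∀ {k} → (Fin k → DiffConstraint R n) → List Inequality
  system C = polymatroidAxioms ++ List.tabulate (constraintInequality ∘ C)

  ⊨polymatroidAxioms⇒IsPolymatroid : ∀ {x} → x ⊨* polymatroidAxioms → IsPolymatroid R x
  ⊨polymatroidAxioms⇒IsPolymatroid {x} x⊨A = record
    { empty      = ≤-antisym (subst (_≤ 0#) (⟦⟨⟩⟧ ⊥ x) (≲-holds ⟨ ⊥ ⟩ [] (here refl)))
                             (subst (0# ≤_) (⟦⟨⟩⟧ ⊥ x) (≲-holds [] ⟨ ⊥ ⟩ (there (here refl))))
    ; nonneg     = λ X _ → subst (0# ≤_) (⟦⟨⟩⟧ X x)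
                     (≲-holds [] ⟨ X ⟩ (in-nonneg (∈-map⁺ nonnegAxiom (∈-allSubsets X))))
    ; monotone   = λ X Y _ _ X⊆Y → subst₂ (λ u v → u ≤ x v) (⟦⟨⟩⟧ X x) (⊆⇒∪≡ X⊆Y)
                     (subst (⟦ ⟨ X ⟩ ⟧ x ≤_) (⟦⟨⟩⟧ (X ∪ Y) x) (≲-holds ⟨ X ⟩ ⟨ X ∪ Y ⟩
                       (in-monotone (∈-cartesianProductWith⁺ monotoneAxiom (∈-allSubsets X) (∈-allSubsets Y)))))
    ; submodular = λ X Y _ _ → subst₂ _≤_ (⟦⊕⟧ (X ∪ Y) (X ∩ Y) x) (⟦⊕⟧ X Y x)
                     (≲-holds (X ∪ Y ⊕ X ∩ Y) (X ⊕ Y)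
                       (in-submodular (∈-cartesianProductWith⁺ submodularAxiom (∈-allSubsets X) (∈-allSubsets Y))))
    }
    where
    ≲-holds : ∀ L M → L ≲ M List.∈ polymatroidAxioms → ⟦ L ⟧ x ≤ ⟦ M ⟧ x
    ≲-holds L M i∈ = Equivalence.to (⊨-≲ x L M) (All.lookup x⊨A i∈)
    in-nonneg : ∀ {i} → i List.∈ map nonnegAxiom subsets → i List.∈ polymatroidAxioms
    in-nonneg = ∈-++⁺ʳ emptyAxioms ∘ ∈-++⁺ˡ
    in-monotone : ∀ {i} → i List.∈ cartesianProductWith monotoneAxiom subsets subsets → i List.∈ polymatroidAxioms
    in-monotone = ∈-++⁺ʳ emptyAxioms ∘ ∈-++⁺ʳ (map nonnegAxiom subsets) ∘ ∈-++⁺ˡ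
    in-submodular : ∀ {i} → i List.∈ cartesianProductWith submodularAxiom subsets subsets → i List.∈ polymatroidAxioms
    in-submodular = ∈-++⁺ʳ emptyAxioms ∘ ∈-++⁺ʳ (map nonnegAxiom subsets)
                  ∘ ∈-++⁺ʳ (cartesianProductWith monotoneAxiom subsets subsets)

  IsPolymatroid⇒⊨polymatroidAxioms : ∀ {x} → IsPolymatroid R x → x ⊨* polymatroidAxioms
  IsPolymatroid⇒⊨polymatroidAxioms {x} x-poly =
    ≲-holds ⟨ ⊥ ⟩ [] (subst₂ _≤_ (sym (⟦⟨⟩⟧ ⊥ x)) refl (≤-reflexive empty)) ∷
    ≲-holds [] ⟨ ⊥ ⟩ (subst₂ _≤_ refl (sym (⟦⟨⟩⟧ ⊥ x)) (≤-reflexive (sym empty))) ∷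
    All.++⁺ (All.map⁺ {f = nonnegAxiom} (All.tabulate {xs = subsets} λ {X} _ →
              ≲-holds [] ⟨ X ⟩ (subst (0# ≤_) (sym (⟦⟨⟩⟧ X x)) (nonneg X ⊆⊤))))
   (All.++⁺ (All.cartesianProductWith⁺ (setoid _) (setoid _) monotoneAxiom subsets subsets λ {X} {Y} _ _ →
              ≲-holds ⟨ X ⟩ ⟨ X ∪ Y ⟩ (subst₂ _≤_ (sym (⟦⟨⟩⟧ X x)) (sym (⟦⟨⟩⟧ (X ∪ Y) x))
                (monotone X (X ∪ Y) ⊆⊤ ⊆⊤ (p⊆p∪q Y))))
            (All.cartesianProductWith⁺ (setoid _) (setoid _) submodularAxiom subsets subsets λ {X} {Y} _ _ →
              ≲-holds (X ∪ Y ⊕ X ∩ Y) (X ⊕ Y) (subst₂ _≤_ (sym (⟦⊕⟧ (X ∪ Y) (X ∩ Y) x)) (sym (⟦⊕⟧ X Y x))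
                (submodular X Y ⊆⊤ ⊆⊤))))
    where
    open IsPolymatroidOn x-poly
    ≲-holds : ∀ L M → ⟦ L ⟧ x ≤ ⟦ M ⟧ x → x ⊨ L ≲ M
    ≲-holds L M = Equivalence.from (⊨-≲ x L M)

  ⊨constraint⇔ : ∀ x dc → x ⊨ constraintInequality dc ⇔ SatisfiesDC R x dc
  ⊨constraint⇔ x dc = ≤-cong (cong (x (DiffConstraint.Y dc) +_) (+-identityʳ _))

  ⊨system⇔ : ∀ {k} (C : Fin k → DiffConstraint R n) x → x ⊨* system C ⇔ (IsPolymatroid R x × SatisfiesAll R C x)
  ⊨system⇔ C x = mk⇔
    (λ x⊨S → ⊨polymatroidAxioms⇒IsPolymatroid (All.++⁻ˡ polymatroidAxioms x⊨S)
           , λ i → Equivalence.to (⊨constraint⇔ x (C i)) (All.tabulate⁻ (All.++⁻ʳ polymatroidAxioms x⊨S) i))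
    (λ (x-poly , x⊨C) → All.++⁺ (IsPolymatroid⇒⊨polymatroidAxioms x-poly)
                                (All.tabulate⁺ λ i → Equivalence.from (⊨constraint⇔ x (C i)) (x⊨C i)))

  polymatroid-bound-attained : ∀ {k} (C : Fin k → DiffConstraint R n) {B} → PolymatroidBoundIs R C B → FeasibleValue R C B
  polymatroid-bound-attained C {B} B-lub =
    let x , x⊨S , x⊤≡B = supremum-attained (allSubsets n) ∈-allSubsets (system C) ⊤ (IsLUB-cong feasible⇔ B-lub)
        x-poly , x⊨C = Equivalence.to (⊨system⇔ C x) x⊨S
    in x , x-poly , x⊨C , x⊤≡B
    where
    feasible⇔ : ∀ a → FeasibleValue R C a ⇔ Feasible (system C) ⊤ a
    feasible⇔ a = mk⇔ (λ (x , x-poly , x⊨C , x⊤≡a) → x , Equivalence.from (⊨system⇔ C x) (x-poly , x⊨C) , x⊤≡a)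
                      (λ (x , x⊨S , x⊤≡a) → let x-poly , x⊨C = Equivalence.to (⊨system⇔ C x) x⊨S in x , x-poly , x⊨C , x⊤≡a)
module ComponentOrder (R : CompleteOrderedField) {n k h} (C : Fin k → DiffConstraint R n)
                      (V : Fin h → Subset n) (V-scc : IsSCCDecomposition R C V) where
  open import Data.Fin.Subset using (_∈_; _∉_)
  open OrderedField R
  open FiniteSums R using (Σ[_]; Σ-reindex; sumBelow; sumBelow-telescope)
  open ≡-Reasoning
  open IsSCCDecomposition V-scc

  component : Fin n → Fin h
  component u = proj₁ (covers u)

  ∈-component : ∀ u → u ∈ V (component u)
  ∈-component u = proj₂ (covers u)

  component-unique : ∀ {u j} → u ∈ V j → component u ≡ j
  component-unique {u} {j} = disjoint (component u) j u (∈-component u)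

  representative : Fin h → Fin n
  representative j = proj₁ (nonempty j)

  ∈-representative : ∀ j → representative j ∈ V j
  ∈-representative j = proj₂ (nonempty j)

  _⇝_ : Fin n → Fin n → Set
  _⇝_ = Star (Arc R C)

  same-component⇒⇝ : ∀ {j u v} → u ∈ V j → v ∈ V j → u ⇝ v
  same-component⇒⇝ {j} {u} {v} u∈ v∈ = proj₁ (Equivalence.to (classes j u v u∈) v∈)

  -- Reachability is only decidable up to double negation, which suffices here.
  ancestor? : ∀ j w → Dec (¬ ¬ (w ⇝ representative j))
  ancestor? j w = ¬¬? (w ⇝ representative j)

  ancestors : Fin h → Subset n
  ancestors j = subsetOf (ancestor? j)

  rank : Fin h → ℕ
  rank j = ∣ ancestors j ∣

  rank-< : ∀ {u v} → Arc R C u v → component u ≢ component v → rank (component u) ℕ.< rank (component v)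
  rank-< {u} {v} arc a≢b = p⊂q⇒∣p∣<∣q∣ (ancestors-⊆ , representative b , ∈-subsetOf⁺ (ancestor? b) (λ ¬r → ¬r ε) , rb∉)
    where
    a b : Fin h
    a = component u
    b = component v
    ra⇝rb : representative a ⇝ representative b
    ra⇝rb = same-component⇒⇝ (∈-representative a) (∈-component u)
         ◅◅ (arc ◅ same-component⇒⇝ (∈-component v) (∈-representative b))
    ancestors-⊆ : ancestors a ⊆ ancestors b
    ancestors-⊆ w∈ = ∈-subsetOf⁺ (ancestor? b) λ ¬w⇝rb →
      ∈-subsetOf⁻ (ancestor? a) w∈ λ w⇝ra → ¬w⇝rb (w⇝ra ◅◅ ra⇝rb)
    rb∉ : representative b ∉ ancestors a
    rb∉ rb∈ = ∈-subsetOf⁻ (ancestor? a) rb∈ λ rb⇝ra → a≢b (disjoint a b (representative b)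
      (Equivalence.from (classes a (representative a) (representative b) (∈-representative a)) (ra⇝rb , rb⇝ra))
      (∈-representative b))

  key : Fin h → ℕ
  key j = rank j ℕ.* h ℕ.+ toℕ j

  key-< : ∀ {i j} → rank i ℕ.< rank j → key i ℕ.< key j
  key-< {i} {j} ri<rj = ℕ.<-≤-trans (ℕ.+-monoʳ-< (rank i ℕ.* h) (Fin.toℕ<n i)) (ℕ.≤-trans
    (ℕ.≤-reflexive (ℕ.+-comm (rank i ℕ.* h) h)) (ℕ.≤-trans (ℕ.*-monoˡ-≤ h ri<rj) (ℕ.m≤m+n (rank j ℕ.* h) (toℕ j))))

  key-injective : ∀ {i j} → key i ≡ key j → i ≡ j
  key-injective {i} {j} ki≡kj with ℕ.<-cmp (rank i) (rank j)
  ... | tri< ri<rj _ _ = ⊥-elim (ℕ.<-irrefl ki≡kj (key-< ri<rj))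
  ... | tri> _ _ rj<ri = ⊥-elim (ℕ.<-irrefl (sym ki≡kj) (key-< rj<ri))
  ... | tri≈ _ ri≡rj _ = Fin.toℕ-injective
    (ℕ.+-cancelˡ-≡ (rank i ℕ.* h) _ _ (trans ki≡kj (cong (λ r → r ℕ.* h ℕ.+ toℕ j) (sym ri≡rj))))

  bound : ℕ
  bound = suc n ℕ.* h

  key<bound : ∀ j → key j ℕ.< bound
  key<bound j = ℕ.<-≤-trans (ℕ.+-monoʳ-< (rank j ℕ.* h) (Fin.toℕ<n j))
    (ℕ.≤-trans (ℕ.≤-reflexive (ℕ.+-comm (rank j ℕ.* h) h)) (ℕ.*-monoˡ-≤ h (ℕ.s≤s (∣p∣≤n (ancestors j)))))

  arc-key : ∀ {u v} → Arc R C u v → component u ≡ component v ⊎ key (component u) ℕ.< key (component v)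
  arc-key {u} {v} arc with component u Fin.≟ component v
  ... | yes a≡b = inj₁ a≡b
  ... | no a≢b  = inj₂ (key-< (rank-< arc a≢b))

  before : ℕ → Subset n
  before m = subsetOf λ u → key (component u) ℕ.<? m

  ∈-before⁺ : ∀ {u m} → key (component u) ℕ.< m → u ∈ before m
  ∈-before⁺ {m = m} = ∈-subsetOf⁺ λ u → key (component u) ℕ.<? m

  ∈-before⁻ : ∀ {u m} → u ∈ before m → key (component u) ℕ.< m
  ∈-before⁻ {m = m} = ∈-subsetOf⁻ λ u → key (component u) ℕ.<? m

  before-0 : before 0 ≡ ⊥
  before-0 = ⊆-antisym (λ u∈ → ⊥-elim (ℕ.n≮0 (∈-before⁻ u∈))) ⊥⊆

  before-bound : before bound ≡ ⊤
  before-bound = ⊆-antisym ⊆⊤ λ {u} _ → ∈-before⁺ (key<bound (component u))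

  before-suc : ∀ {m} → (∀ j → key j ≢ m) → before (suc m) ≡ before m
  before-suc {m} ∄j = ⊆-antisym (λ {u} u∈ → ∈-before⁺ ([ id , (λ k≡m → ⊥-elim (∄j (component u) k≡m)) ]′
                                    (ℕ.m≤n⇒m<n∨m≡n (ℕ.s≤s⁻¹ (∈-before⁻ u∈)))))
                                 (λ u∈ → ∈-before⁺ (ℕ.m<n⇒m<1+n (∈-before⁻ u∈)))

  increment : (Subset n → Carrier) → ℕ → Carrier
  increment F m = F (before (suc m)) - F (before m)

  Σ-increment : ∀ F → Σ[ increment F ∘ key ] ≡ F ⊤ - F ⊥
  Σ-increment F = begin
    Σ[ increment F ∘ key ]                        ≡⟨ Σ-reindex key key-injective (increment F) vanishes bound key<bound ⟩
    sumBelow bound (increment F)                  ≡⟨ sumBelow-telescope (F ∘ before) bound ⟩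
    F (before bound) - F (before 0)               ≡⟨ cong₂ (λ A B → F A - F B) before-bound before-0 ⟩
    F ⊤ - F ⊥                                     ∎
    where
    vanishes : ∀ m → (∀ j → key j ≢ m) → increment F m ≡ 0#
    vanishes m ∄j = trans (cong (λ A → F A - F (before m)) (before-suc ∄j)) (-‿inverseʳ _)

  before-suc-key : ∀ j → before (suc (key j)) ⊆ before (key j) ∪ V j
  before-suc-key j {u} u∈ with ℕ.m≤n⇒m<n∨m≡n (ℕ.s≤s⁻¹ (∈-before⁻ u∈))
  ... | inj₁ k<kj = x∈p∪q⁺ (inj₁ (∈-before⁺ k<kj))
  ... | inj₂ k≡kj = x∈p∪q⁺ (inj₂ (subst (λ c → u ∈ V c) (key-injective k≡kj) (∈-component u)))

  V⊆before-suc-key : ∀ j → V j ⊆ before (suc (key j))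
  V⊆before-suc-key j u∈ = ∈-before⁺ (subst (λ c → key c ℕ.< suc (key j)) (sym (component-unique u∈)) (ℕ.n<1+n _))

module Semimodularisation (R : CompleteOrderedField) {n k h} (C : Fin k → DiffConstraint R n)
    (V : Fin h → Subset n) (V-scc : IsSCCDecomposition R C V)
    {g : Subset n → CompleteOrderedField.Carrier R} (g-poly : IsPolymatroid R g) (g⊨C : SatisfiesAll R C g) where
  open import Data.Fin.Subset using (_∈_; _∉_)
  open OrderedField R
  open FiniteSums R using (Σ[_]; Σ-mono-≤; Σ-difference)
  open Polymatroids R
  open ComponentOrder R C V V-scc
  open IsPolymatroidOn g-poly

  g-mono : ∀ {X Y} → X ⊆ Y → g X ≤ g Y
  g-mono = IsPolymatroid-mono g-poly

  part : Fin h → Subset n → Carrier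
  part j = contract g (before (key j))

  f : Subset n → Carrier
  f X = Σ[ (λ j → part j (X ∩ V j)) ]

  f-isPolymatroid : IsPolymatroid R f
  f-isPolymatroid = IsPolymatroid-Σ λ j → IsPolymatroid-restrict (IsPolymatroid-contract g-poly _) (V j)

  g⊤≤f⊤ : g ⊤ ≤ f ⊤
  g⊤≤f⊤ = subst₂ _≤_ (trans (Σ-increment g) (trans (cong (λ z → g ⊤ - z) empty) (trans (cong (g ⊤ +_) -0#≈0#) (+-identityʳ _))))
    refl (Σ-mono-≤ λ j → +-mono-≤ (- g (before (key j)))
      (g-mono (subst (λ A → before (suc (key j)) ⊆ before (key j) ∪ A) (sym (∩-identityˡ (V j))) (before-suc-key j))))

  module _ (i : Fin k) where
    open DiffConstraint (C i)

    X⊆Y : X ⊆ Y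
    X⊆Y = proj₁ X⊂Y

    between : Subset n → Carrier
    between T = g (X ∪ (Y ∩ T))

    between-mono : ∀ m → between (before m) ≤ between (before (suc m))
    between-mono m = g-mono λ u∈ → x∈p∪q⁺ (Sum.map₂ (λ u∈Y∩ → let u∈Y , u∈B = x∈p∩q⁻ Y _ u∈Y∩ in
      x∈p∩q⁺ (u∈Y , ∈-before⁺ (ℕ.m<n⇒m<1+n (∈-before⁻ u∈B)))) (x∈p∪q⁻ X _ u∈))

    part-increase-none : ∀ j → Y ∩ V j ⊆ X ∩ V j → part j (Y ∩ V j) - part j (X ∩ V j) ≤ increment between (key j)
    part-increase-none j Y∩Vj⊆X∩Vj = ≤-trans
      (x≤y⇒x-y≤0 (+-mono-≤ _ (g-mono λ u∈ → x∈p∪q⁺ (Sum.map₂ Y∩Vj⊆X∩Vj (x∈p∪q⁻ _ _ u∈)))))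
      (x≤y⇒0≤y-x (between-mono (key j)))

    -- Every u ∈ X has an arc to v, so X ⊆ A; submodularity of g on A and W₁ then gives the bound.
    part-increase-entering : ∀ j {v} → v ∈ Y → v ∉ X → v ∈ V j →
                             part j (Y ∩ V j) - part j (X ∩ V j) ≤ increment between (key j)
    part-increase-entering j {v} v∈Y v∉X v∈V = ≤-rearrange (- g A - g W₀)
        (solve 4 (λ a b c w → a :+ w :+ (:- c :- w) := a :- b :- (c :- b)) refl (g (P ∪ (Y ∩ V j))) (g P) (g A) (g W₀))
        (solve 3 (λ c w₁ w → c :+ w₁ :+ (:- c :- w) := w₁ :- w) refl (g A) (g W₁) (g W₀))
        (≤-trans (+-mono₂-≤ (g-mono P∪Y∩Vj⊆A∪W₁) (g-mono W₀⊆A∩W₁)) (submodular A W₁ ⊆⊤ ⊆⊤))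
      where
      P A W₀ W₁ : Subset n
      P = before (key j)
      A = P ∪ (X ∩ V j)
      W₀ = X ∪ (Y ∩ P)
      W₁ = X ∪ (Y ∩ before (suc (key j)))
      X⊆A : X ⊆ A
      X⊆A {u} u∈X with arc-key (i , u∈X , v∈Y , v∉X)
      ... | inj₁ cu≡cv = x∈p∪q⁺ (inj₂ (x∈p∩q⁺
                           (u∈X , subst (λ c → u ∈ V c) (trans cu≡cv (component-unique v∈V)) (∈-component u))))
      ... | inj₂ ku<kv = x∈p∪q⁺ (inj₁ (∈-before⁺ (subst (λ c → key (component u) ℕ.< key c) (component-unique v∈V) ku<kv)))
      Y∩P⊆W₁ : Y ∩ P ⊆ W₁
      Y∩P⊆W₁ u∈ = let u∈Y , u∈P = x∈p∩q⁻ Y P u∈ in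
        x∈p∪q⁺ (inj₂ (x∈p∩q⁺ (u∈Y , ∈-before⁺ (ℕ.m<n⇒m<1+n (∈-before⁻ u∈P)))))
      P∪Y∩Vj⊆A∪W₁ : P ∪ (Y ∩ V j) ⊆ A ∪ W₁
      P∪Y∩Vj⊆A∪W₁ u∈ = x∈p∪q⁺ (Sum.map (p⊆p∪q _) (λ u∈Y∩V → let u∈Y , u∈V = x∈p∩q⁻ Y (V j) u∈Y∩V in
        x∈p∪q⁺ (inj₂ (x∈p∩q⁺ (u∈Y , V⊆before-suc-key j u∈V)))) (x∈p∪q⁻ P _ u∈))
      W₀⊆A∩W₁ : W₀ ⊆ A ∩ W₁
      W₀⊆A∩W₁ u∈ = [ (λ u∈X → x∈p∩q⁺ (X⊆A u∈X , x∈p∪q⁺ (inj₁ u∈X)))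
                   , (λ u∈Y∩P → x∈p∩q⁺ (p⊆p∪q _ (proj₂ (x∈p∩q⁻ Y P u∈Y∩P)) , Y∩P⊆W₁ u∈Y∩P))
                   ]′ (x∈p∪q⁻ X _ u∈)

    part-increase : ∀ j → part j (Y ∩ V j) - part j (X ∩ V j) ≤ increment between (key j)
    part-increase j with Fin.any? (λ v → v ∈? Y ×-dec (¬? (v ∈? X) ×-dec v ∈? V j))
    ... | yes (v , v∈Y , v∉X , v∈V) = part-increase-entering j v∈Y v∉X v∈V
    ... | no ∄v = part-increase-none j Y∩Vj⊆X∩Vj
      where
      Y∩Vj⊆X∩Vj : Y ∩ V j ⊆ X ∩ V j
      Y∩Vj⊆X∩Vj {u} u∈ with x∈p∩q⁻ Y (V j) u∈ | u ∈? X
      ... | _   , u∈V | yes u∈X = x∈p∩q⁺ (u∈X , u∈V)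
      ... | u∈Y , u∈V | no u∉X  = ⊥-elim (∄v (u , u∈Y , u∉X , u∈V))

    f⊨constraint : SatisfiesDC R f (C i)
    f⊨constraint = begin
      f Y - f X                                          ≡⟨ Σ-difference (λ j → part j (Y ∩ V j)) (λ j → part j (X ∩ V j)) ⟨
      Σ[ (λ j → part j (Y ∩ V j) - part j (X ∩ V j)) ]  ≤⟨ Σ-mono-≤ part-increase ⟩
      Σ[ increment between ∘ key ]                       ≡⟨ Σ-increment between ⟩
      between ⊤ - between ⊥                              ≡⟨ cong₂ (λ A B → g A - g B) between-⊤ between-⊥ ⟩
      g Y - g X                                          ≤⟨ g⊨C i ⟩
      c                                                  ∎
      where
      open ≤-Reasoning
      between-⊤ : X ∪ (Y ∩ ⊤) ≡ Y
      between-⊤ = trans (cong (X ∪_) (∩-identityʳ Y)) (⊆⇒∪≡ X⊆Y)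
      between-⊥ : X ∪ (Y ∩ ⊥) ≡ X
      between-⊥ = trans (cong (X ∪_) (∩-zeroʳ Y)) (∪-identityʳ X)

  f⊨C : SatisfiesAll R C f
  f⊨C = f⊨constraint

  part-isPolymatroidOn : ∀ j → IsPolymatroidOn R (V j) (part j)
  part-isPolymatroidOn j = IsPolymatroid⇒IsPolymatroidOn (IsPolymatroid-contract g-poly (before (key j)))

open import Data.Nat using (_≤_)

mainTheorem2 : (R : CompleteOrderedField) (n : ℕ) → 1 ≤ n →
    (k : ℕ) (C : Fin k → DiffConstraint R n) →
    (h : ℕ) (V : Fin h → Subset n) → IsSCCDecomposition R C V →
    (B : CompleteOrderedField.Carrier R) → PolymatroidBoundIs R C B →
    Σ (Subset n → CompleteOrderedField.Carrier R) λ f →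
      IsPolymatroid R f × SatisfiesAll R C f × f ⊤ ≡ B × SemimodularWrt R V f
mainTheorem2 R n _ k C h V V-scc B B-lub = f , f-isPolymatroid , f⊨C , f⊤≡B , part , part-isPolymatroidOn , λ _ → refl
  where
  open CompleteOrderedField R using (Carrier; ≤-antisym) renaming (_≤_ to _≤ᴿ_)

  optimum : FeasibleValue R C B
  optimum = PolymatroidProgram.polymatroid-bound-attained R n C B-lub

  g : Subset n → Carrier
  g = proj₁ optimum

  g-poly : IsPolymatroid R g
  g-poly = proj₁ (proj₂ optimum)

  g⊨C : SatisfiesAll R C g
  g⊨C = proj₁ (proj₂ (proj₂ optimum))

  g⊤≡B : g ⊤ ≡ B
  g⊤≡B = proj₂ (proj₂ (proj₂ optimum))

  open Semimodularisation R C V V-scc g-poly g⊨C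

  f⊤≡B : f ⊤ ≡ B
  f⊤≡B = ≤-antisym (proj₁ B-lub (f ⊤) (f , f-isPolymatroid , f⊨C , refl)) (subst (_≤ᴿ f ⊤) g⊤≡B g⊤≤f⊤)
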